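{- Let $G$ be a unicyclic graph whose cycle is labelled $u_1u_2\cdots u_kw_kw_{k-1}\cdots w_1u_1$ if $\gamma=2k$, or $u_1u_2\cdots u_kw_{k-1}\cdots w_1u_1$ if $\gamma=2k-1$. Let $e=u_kw_k$ if $\gamma=2k$ and $e=u_kw_{k-1}$ if $\gamma=2k-1$, let $T_G=G-e$, and set $\Delta(G)=W(T_G)-W(G)$. Then for $\gamma=2k$, \[\Delta(G)=\sum_{i=2}^{k}\sum_{j=k+2-i}^{k}2(i+j-k-1)\,|V(U_i)|\,|V(W_j)|,\] and for $\gamma=2k-1$, \[\Delta(G)=\sum_{i=2}^{k}\sum_{j=k+1-i}^{k-1}\bigl(2(i+j-k)-1\bigr)\,|V(U_i)|\,|V(W_j)|.\]
   Context: All graphs are finite, simple, undirected. A unicyclic graph is a connected graph with exactly one cycle; its girth $\gamma$ is the cycle length. $W(H)=\sum_{\{u,v\}}d_H(u,v)$ over unordered vertex pairs. For a cycle vertex $x$, the tree attached at $x$ is the component containing $x$ of $G$ minus the cycle edges; $U_i,W_i$ are the trees attached at $u_i,w_i$. -}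

module Defs where

open import Data.Bool using (Bool; true; false; _∧_; _∨_; not; if_then_else_)
open import Data.Nat using (ℕ; zero; suc; _+_; _*_; _∸_; _≤_; _<ᵇ_)
open import Data.Nat.DivMod using (_mod_)
open import Data.Fin using (Fin; toℕ; _≟_)
open import Data.List using (List; map; upTo)
open import Data.Nat.ListAction using (sum)
open import Data.Bool.ListAction using (any)
open import Data.List using () renaming (allFin to allFinL)
open import Data.Product using (Σ; ∃; ∃-syntax; _×_; _,_)
open import Data.Integer using (ℤ; +_; _-_)
open import Function using (_∘_)
open import Function.Definitions using (Injective)
open import Relation.Nullary using (does)
open import Relation.Binary.PropositionalEquality using (_≡_)

Adj : ℕ → Set
Adj n = Fin n → Fin n → Bool

record Graph (n : ℕ) : Set where
  field
    adj    : Adj n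
    sym    : ∀ u v → adj u v ≡ adj v u
    irrefl : ∀ v → adj v v ≡ false
open Graph public

_==_ : ∀ {n} → Fin n → Fin n → Bool
a == b = does (a ≟ b)

anyFin : ∀ {n} → (Fin n → Bool) → Bool
anyFin {n} p = any p (allFinL n)

countFin : ∀ {n} → (Fin n → Bool) → ℕ
countFin {n} p = sum (map (λ v → if p v then 1 else 0) (allFinL n))

reachWithin : ∀ {n} → Adj n → ℕ → Fin n → Fin n → Bool
reachWithin A zero    u v = u == v
reachWithin A (suc k) u v =
  reachWithin A k u v ∨ anyFin (λ w → reachWithin A k u w ∧ A w v)

-- least k < m with p k, or m if there is none
least : (ℕ → Bool) → ℕ → ℕ
least p zero    = 0
least p (suc m) = if p 0 then 0 else suc (least (p ∘ suc) m)

-- distance = length of a shortest walk (= shortest path); in a connected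
-- graph on n vertices this is < n, so searching k ∈ {0..n} suffices
dist : ∀ {n} → Adj n → Fin n → Fin n → ℕ
dist {n} A u v = least (λ k → reachWithin A k u v) n

Connected : ∀ {n} → Adj n → Set
Connected A = ∀ u v → ∃[ k ] reachWithin A k u v ≡ true

Wiener : ∀ {n} → Adj n → ℕ
Wiener {n} A = sum (map (λ u → sum (map (λ v →
  if toℕ u <ᵇ toℕ v then dist A u v else 0) (allFinL n))) (allFinL n))

next : ∀ {m} → Fin (suc m) → Fin (suc m)
next {m} i = suc (toℕ i) mod (suc m)

record IsCycle {n : ℕ} (G : Graph n) {m : ℕ} (c : Fin (suc m) → Fin n) : Set where
  field
    length≥3 : 3 ≤ suc m
    injective : Injective _≡_ _≡_ c
    adjacent  : ∀ i → adj G (c i) (c (next i)) ≡ true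

cycleEdge : ∀ {n m} → (Fin (suc m) → Fin n) → Fin n → Fin n → Bool
cycleEdge c a b = anyFin (λ i →
  ((a == c i) ∧ (b == c (next i))) ∨ ((a == c (next i)) ∧ (b == c i)))

-- connected with exactly one cycle (cycles identified by their edge sets)
Unicyclic : ∀ {n} → Graph n → Set
Unicyclic {n} G =
  Connected (adj G) ×
  Σ ℕ (λ m → Σ (Fin (suc m) → Fin n) (λ c → IsCycle G c ×
    (∀ m' (c' : Fin (suc m') → Fin n) → IsCycle G c' →
       ∀ a b → cycleEdge c' a b ≡ cycleEdge c a b)))

minusCycle : ∀ {n m} → Graph n → (Fin (suc m) → Fin n) → Adj n
minusCycle G c a b = adj G a b ∧ not (cycleEdge c a b)

-- |V(tree attached at cycle vertex x)| = size of the component of x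
-- in G minus the cycle edges
treeSize : ∀ {n m} → Graph n → (Fin (suc m) → Fin n) → Fin n → ℕ
treeSize {n} G c x = countFin (λ v → reachWithin (minusCycle G c) n x v)

removeEdge : ∀ {n} → Adj n → Fin n → Fin n → Adj n
removeEdge A x y a b = A a b ∧ not (((a == x) ∧ (b == y)) ∨ ((a == y) ∧ (b == x)))

Δ : ∀ {n} → Graph n → Fin n → Fin n → ℤ
Δ G x y = + Wiener (removeEdge (adj G) x y) - + Wiener (adj G)

at : ∀ {n m} → (Fin (suc m) → Fin n) → ℕ → Fin n
at {m = m} c i = c (i mod suc m)

-- Σ_{i=a}^{b} f i  (empty if b < a)
sumFromTo : ℕ → ℕ → (ℕ → ℕ) → ℕ
sumFromTo a b f = sum (map (λ t → f (a + t)) (upTo (suc b ∸ a)))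

-- labelling: u_i = c(i-1) (1 ≤ i ≤ k);
-- even γ = 2k: w_j = c(2k - j);  odd γ = 2k-1: w_j = c(2k-1-j)  (1 ≤ j)
uV : ∀ {n m} → (Fin (suc m) → Fin n) → ℕ → Fin n
uV c i = at c (i ∸ 1)

wEven : ∀ {n m} → ℕ → (Fin (suc m) → Fin n) → ℕ → Fin n
wEven k c j = at c (2 * k ∸ j)

wOdd : ∀ {n m} → ℕ → (Fin (suc m) → Fin n) → ℕ → Fin n
wOdd k c j = at c (2 * k ∸ 1 ∸ j)

module Submission where

-- Let F be G without its cycle edges and T = G - e. As the cycle is unique, distinct cycle
-- vertices lie in different components of F (a shortest F-path between two of them would close
-- a second cycle), so each vertex v has a root on the cycle and a depth in its tree. In every
-- graph B between F and G the distance of two vertices in different trees is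
-- depth + (distance in B of the roots) + depth, and is their F-distance otherwise; between cycle
-- positions the distance is min (|p - q|, γ - |p - q|) in G and the distance along the path
-- C - e in T. Hence W(T) - W(G) sums, over unordered pairs of cycle positions, the product of the
-- tree sizes times the excess of the path distance over the cycle distance. The excess vanishes
-- unless the positions lie on opposite sides of e, where it is 2(a - b) for even γ and
-- 2(a - b) - 1 for odd γ; reindexing these cross pairs gives the two double sums.

open import Defs hiding (sym)
open import Data.Bool using (Bool; true; false; _∧_; _∨_; not; if_then_else_)
open import Data.Bool.Properties using (∨-comm; ∧-comm; ∧-conicalˡ; ∧-conicalʳ; ∧-zeroʳ)
open import Data.Bool.ListAction using (any)
open import Data.Nat using (ℕ; zero; suc; _+_; _*_; _∸_; _≤_; _<_; z≤n; s≤s; _<?_; _≤?_; _⊓_; ∣_-_∣; _<ᵇ_; _≡ᵇ_) renaming (_≟_ to _≟ℕ_)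
open import Data.Nat.Properties hiding (_≟_)
open import Data.Nat.DivMod using (_mod_; _%_; m<n⇒m%n≡m; n%n≡0; [m+n]%n≡m%n; %-distribˡ-+; m%n%n≡m%n)
open import Data.Nat.ListAction using (sum)
open import Data.Nat.Tactic.RingSolver
open import Data.Fin using (Fin; toℕ; _≟_)
open import Data.Fin.Properties using (toℕ-injective; toℕ-fromℕ<; toℕ<n; any?; ¬∀⟶∃¬)
open import Data.List using (List; []; _∷_; map; length; upTo; applyUpTo) renaming (allFin to allFinL)
open import Data.List.Properties using (map-cong; length-tabulate)
open import Data.List.Membership.Propositional using (_∈_)
open import Data.List.Membership.Propositional.Properties using (∈-allFin)
open import Data.List.Relation.Unary.Any using (here; there)
import Data.Integer as ℤ
open import Data.Integer.Properties using (m-n≡m⊖n; ⊖-≥)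
open import Data.Product using (∃; ∃-syntax; _×_; _,_; proj₁; proj₂)
open import Data.Sum using (_⊎_; inj₁; inj₂)
open import Data.Empty using (⊥; ⊥-elim)
open import Data.Unit using (⊤; tt)
open import Function using (_∘_)
open import Relation.Nullary using (¬_; Dec; yes; no)
open import Relation.Binary.PropositionalEquality
open import Relation.Binary.Definitions using (Tri; tri<; tri≈; tri>)

∨-trueˡ : ∀ {a} b → a ≡ true → a ∨ b ≡ true
∨-trueˡ b refl = refl

∨-trueʳ : ∀ a {b} → b ≡ true → a ∨ b ≡ true
∨-trueʳ true refl = refl
∨-trueʳ false refl = refl

∨-true⁻ : ∀ a b → a ∨ b ≡ true → a ≡ true ⊎ b ≡ true
∨-true⁻ true b _ = inj₁ refl
∨-true⁻ false b e = inj₂ e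

∧-true : ∀ {a b} → a ≡ true → b ≡ true → a ∧ b ≡ true
∧-true refl refl = refl

true≢false : ∀ {a} → a ≡ true → a ≡ false → ⊥
true≢false refl ()

not-true⇒false : ∀ a → not a ≡ true → a ≡ false
not-true⇒false false _ = refl

false⇒not-true : ∀ a → a ≡ false → not a ≡ true
false⇒not-true false _ = refl

≡true? : ∀ b → Dec (b ≡ true)
≡true? true = yes refl
≡true? false = no (λ ())

¬true⇒false : ∀ b → ¬ (b ≡ true) → b ≡ false
¬true⇒false true h = ⊥-elim (h refl)
¬true⇒false false h = refl

==⇒≡ : ∀ {n} {a b : Fin n} → (a == b) ≡ true → a ≡ b
==⇒≡ {a = a} {b} e with a ≟ b
... | yes p = p
==⇒≡ () | no _

==-refl : ∀ {n} (a : Fin n) → (a == a) ≡ true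
==-refl a with a ≟ a
... | yes _ = refl
... | no ¬p = ⊥-elim (¬p refl)

≢⇒==-false : ∀ {n} {a b : Fin n} → ¬ a ≡ b → (a == b) ≡ false
≢⇒==-false {a = a} {b} ne with a ≟ b
... | yes p = ⊥-elim (ne p)
... | no _ = refl

any⇒∃ : ∀ {A : Set} (p : A → Bool) xs → any p xs ≡ true → ∃[ x ] p x ≡ true
any⇒∃ p (x ∷ xs) e with ∨-true⁻ (p x) (any p xs) e
... | inj₁ q = x , q
... | inj₂ q = any⇒∃ p xs q

∈⇒any : ∀ {A : Set} (p : A → Bool) {xs x} → x ∈ xs → p x ≡ true → any p xs ≡ true
∈⇒any p {x ∷ xs} (here refl) q = ∨-trueˡ (any p xs) q
∈⇒any p {y ∷ xs} (there m) q = ∨-trueʳ (p y) (∈⇒any p m q)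

anyFin⇒∃ : ∀ {n} (p : Fin n → Bool) → anyFin p ≡ true → ∃[ x ] p x ≡ true
anyFin⇒∃ {n} p e = any⇒∃ p (allFinL n) e

anyFin-intro : ∀ {n} (p : Fin n → Bool) x → p x ≡ true → anyFin p ≡ true
anyFin-intro {n} p x q = ∈⇒any p (∈-allFin x) q

anyFin-cong : ∀ {n} (p q : Fin n → Bool) → (∀ x → p x ≡ q x) → anyFin p ≡ anyFin q
anyFin-cong {n} p q f = cong (Data.List.foldr _∨_ false) (map-cong f (allFinL n))

anyFin-false : ∀ {m} (p : Fin m → Bool) → anyFin p ≡ false → ∀ z → p z ≡ false
anyFin-false p e z = ¬true⇒false (p z) (λ q → true≢false (anyFin-intro p z q) e)

-- Walks and distances

module _ {n : ℕ} (A : Adj n) where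
  private
    R = reachWithin A

  reach-refl : ∀ u → R 0 u u ≡ true
  reach-refl u = ==-refl u

  reach-zero⇒≡ : ∀ {u v} → R 0 u v ≡ true → u ≡ v
  reach-zero⇒≡ e = ==⇒≡ e

  reach-suc : ∀ k {u v} → R k u v ≡ true → R (suc k) u v ≡ true
  reach-suc k {u} {v} e = ∨-trueˡ _ e

  reach-snoc : ∀ k {u w v} → R k u w ≡ true → A w v ≡ true → R (suc k) u v ≡ true
  reach-snoc k {u} {w} {v} e a = ∨-trueʳ (R k u v) (anyFin-intro (λ x → R k u x ∧ A x v) w (∧-true e a))

  reach-suc⁻ : ∀ k {u v} → R (suc k) u v ≡ true → R k u v ≡ true ⊎ ∃[ w ] (R k u w ≡ true × A w v ≡ true)
  reach-suc⁻ k {u} {v} e with ∨-true⁻ (R k u v) _ e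
  ... | inj₁ q = inj₁ q
  ... | inj₂ q with anyFin⇒∃ _ q
  ... | w , r = inj₂ (w , ∧-conicalˡ _ _ r , ∧-conicalʳ _ _ r)

  reach-mono : ∀ {j k u v} → j ≤ k → R j u v ≡ true → R k u v ≡ true
  reach-mono {k = zero} z≤n e = e
  reach-mono {zero} {suc k} z≤n e = reach-suc k (reach-mono {zero} {k} z≤n e)
  reach-mono {suc j} {suc k} (s≤s le) e with reach-suc⁻ j e
  ... | inj₁ q = reach-suc k (reach-mono le q)
  ... | inj₂ (w , q , a) = reach-snoc k (reach-mono le q) a

  reach-edge : ∀ {u v} → A u v ≡ true → R 1 u v ≡ true
  reach-edge {u} {v} a = reach-snoc 0 {u} {u} {v} (reach-refl u) a

  reach-++ : ∀ j k {u w v} → R j u w ≡ true → R k w v ≡ true → R (j + k) u v ≡ true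
  reach-++ j zero {u} {w} {v} e f = subst₂ (λ a z → R a u z ≡ true) (sym (+-identityʳ j)) (reach-zero⇒≡ {w} {v} f) e
  reach-++ j (suc k) {u} {w} {v} e f with reach-suc⁻ k f
  ... | inj₁ q = subst (λ z → R z u v ≡ true) (sym (+-suc j k)) (reach-suc (j + k) (reach-++ j k e q))
  ... | inj₂ (x , q , a) = subst (λ z → R z u v ≡ true) (sym (+-suc j k)) (reach-snoc (j + k) (reach-++ j k e q) a)

  module Sym (Asym : ∀ u v → A u v ≡ A v u) where
    reach-sym : ∀ k {u v} → R k u v ≡ true → R k v u ≡ true
    reach-sym zero {u} {v} e = subst (λ z → R 0 z u ≡ true) (reach-zero⇒≡ {u} {v} e) (reach-refl u)
    reach-sym (suc k) {u} {v} e with reach-suc⁻ k e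
    ... | inj₁ q = reach-suc k (reach-sym k q)
    ... | inj₂ (w , q , a) = reach-++ 1 k {v} {w} {u} (reach-edge (trans (Asym v w) a)) (reach-sym k q)

  reach-potential : (φ : Fin n → ℕ) → (∀ w x → A w x ≡ true → φ x ≤ suc (φ w)) →
          ∀ k {u v} → R k u v ≡ true → φ v ≤ φ u + k
  reach-potential φ lip zero {u} {v} e = subst₂ (λ a z → φ z ≤ a) (sym (+-identityʳ (φ u))) (reach-zero⇒≡ {u} {v} e) ≤-refl
  reach-potential φ lip (suc k) {u} {v} e with reach-suc⁻ k e
  ... | inj₁ q = ≤-trans (reach-potential φ lip k q) (+-monoʳ-≤ (φ u) (n≤1+n k))
  ... | inj₂ (w , q , a) = ≤-trans (lip w v a) (subst (suc (φ w) ≤_) (sym (+-suc (φ u) k)) (s≤s (reach-potential φ lip k q)))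

reach-⊆ : ∀ {n} (A B : Adj n) → (∀ a b → A a b ≡ true → B a b ≡ true) →
        ∀ k {u v} → reachWithin A k u v ≡ true → reachWithin B k u v ≡ true
reach-⊆ A B s zero e = e
reach-⊆ A B s (suc k) e with reach-suc⁻ A k e
... | inj₁ q = reach-suc B k (reach-⊆ A B s k q)
... | inj₂ (w , q , a) = reach-snoc B k (reach-⊆ A B s k q) (s _ _ a)

indicator : Bool → ℕ
indicator b = if b then 1 else 0

count : ∀ {A : Set} → (A → Bool) → List A → ℕ
count p xs = sum (map (λ v → indicator (p v)) xs)

indicator-≤1 : ∀ b → indicator b ≤ 1
indicator-≤1 true = ≤-refl
indicator-≤1 false = z≤n

indicator-mono : ∀ a b → (a ≡ true → b ≡ true) → indicator a ≤ indicator b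
indicator-mono true b f rewrite f refl = ≤-refl
indicator-mono false b f = z≤n

count-≤-length : ∀ {A : Set} (p : A → Bool) xs → count p xs ≤ length xs
count-≤-length p [] = z≤n
count-≤-length p (x ∷ xs) = +-mono-≤ (indicator-≤1 (p x)) (count-≤-length p xs)

count-mono : ∀ {A : Set} (p q : A → Bool) → (∀ v → p v ≡ true → q v ≡ true) → ∀ xs → count p xs ≤ count q xs
count-mono p q f [] = z≤n
count-mono p q f (x ∷ xs) = +-mono-≤ (indicator-mono (p x) (q x) (f x)) (count-mono p q f xs)

count-mono-< : ∀ {A : Set} (p q : A → Bool) → (∀ v → p v ≡ true → q v ≡ true) → ∀ {xs w} → w ∈ xs →
             p w ≡ false → q w ≡ true → count p xs < count q xs
count-mono-< p q f {x ∷ xs} (here refl) pf qt rewrite pf | qt = s≤s (count-mono p q f xs)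
count-mono-< p q f {x ∷ xs} (there m) pf qt = +-mono-≤-< (indicator-mono (p x) (q x) (f x)) (count-mono-< p q f m pf qt)

count-false : ∀ {A : Set} (xs : List A) → count (λ _ → false) xs ≡ 0
count-false [] = refl
count-false (x ∷ xs) = count-false xs

countFin-≤ : ∀ {n} (p : Fin n → Bool) → countFin p ≤ n
countFin-≤ {n} p = subst (countFin p ≤_) (length-tabulate (λ x → x)) (count-≤-length p (allFinL n))

least-≤ : ∀ p m → least p m ≤ m
least-≤ p zero = z≤n
least-≤ p (suc m) with p 0
... | true = z≤n
... | false = s≤s (least-≤ (p ∘ suc) m)

least-sound : ∀ p m → least p m < m → p (least p m) ≡ true
least-sound p (suc m) lt with p 0 in eq
... | true = eq
... | false = least-sound (p ∘ suc) m (≤-pred lt)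

least-minimal : ∀ p m j → j < m → p j ≡ true → least p m ≤ j
least-minimal p (suc m) j lt e with p 0 in eq
... | true = z≤n
least-minimal p (suc m) zero lt e | false = ⊥-elim (true≢false e eq)
least-minimal p (suc m) (suc j) lt e | false = s≤s (least-minimal (p ∘ suc) m j (≤-pred lt) e)

least-cong : ∀ p q m → (∀ j → p j ≡ q j) → least p m ≡ least q m
least-cong p q zero f = refl
least-cong p q (suc m) f rewrite f 0 with q 0
... | true = refl
... | false = cong suc (least-cong (p ∘ suc) (q ∘ suc) m (f ∘ suc))

least-below : ∀ p m j → j < least p m → p j ≡ false
least-below p m j lt = ¬true⇒false (p j) (λ e → <⇒≱ lt (least-minimal p m j (≤-trans lt (least-≤ p m)) e))

-- The balls around u grow until they stop growing and then stay fixed; they cannot grow n times,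
-- so whatever u reaches it reaches within n ∸ 1 steps.
module Shortening {n : ℕ} (A : Adj n) (u : Fin n) where
  Ball : ℕ → Fin n → Bool
  Ball j = reachWithin A j u

  Stable : ℕ → Set
  Stable j = ∀ v → Ball (suc j) v ≡ true → Ball j v ≡ true

  stable-suc : ∀ j → Stable j → Stable (suc j)
  stable-suc j st v e with reach-suc⁻ A (suc j) e
  ... | inj₁ q = q
  ... | inj₂ (w , q , a) = reach-snoc A j (st w q) a

  stable-up : ∀ j → Stable j → ∀ d → Stable (d + j)
  stable-up j st zero = st
  stable-up j st (suc d) = stable-suc (d + j) (stable-up j st d)

  stable-down : ∀ j → Stable j → ∀ d v → Ball (d + j) v ≡ true → Ball j v ≡ true
  stable-down j st zero v e = e
  stable-down j st (suc d) v e = stable-down j st d v (stable-up j st d v e)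

  stable-everywhere : ∀ j → Stable j → ∀ i v → Ball i v ≡ true → Ball j v ≡ true
  stable-everywhere j st i v e with ≤-total i j
  ... | inj₁ le = reach-mono A le e
  ... | inj₂ le = stable-down j st (i ∸ j) v (subst (λ z → Ball z v ≡ true) (sym (m∸n+n≡m le)) e)

  decImp : ∀ a b → Dec (a ≡ true → b ≡ true)
  decImp _ true = yes (λ _ → refl)
  decImp false false = yes (λ ())
  decImp true false = no (λ f → true≢false (f refl) refl)

  decP : ∀ j v → Dec (Ball (suc j) v ≡ true → Ball j v ≡ true)
  decP j v = decImp (Ball (suc j) v) (Ball j v)

  decStable : ∀ j → Dec (Stable j)
  decStable j with Data.Fin.Properties.all? (decP j)
  ... | yes p = yes p
  ... | no ¬p = no ¬p

  stable-or-growing : ∀ j → (∃[ j' ] (j' < j × Stable j')) ⊎ (suc j ≤ countFin (Ball j))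
  stable-or-growing zero = inj₂ (subst (λ z → suc z ≤ countFin (Ball 0)) (count-false (allFinL n)) (count-mono-< (λ _ → false) (Ball 0) (λ _ ()) (∈-allFin u) refl (reach-refl A u)))
  stable-or-growing (suc j) with stable-or-growing j
  ... | inj₁ (j' , lt , st) = inj₁ (j' , ≤-trans lt (n≤1+n j) , st)
  ... | inj₂ c with decStable j
  ... | yes st = inj₁ (j , ≤-refl , st)
  ... | no ¬st with ¬∀⟶∃¬ n _ (decP j) ¬st
  ... | v , ¬P = inj₂ (≤-trans (s≤s c) (count-mono-< (Ball j) (Ball (suc j)) (λ v e → reach-suc A j e) (∈-allFin v) (lemF (Ball j v) ¬P) (lemT (Ball (suc j) v) ¬P)))
    where
    lemF : ∀ {X : Set} c → ¬ (X → c ≡ true) → c ≡ false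
    lemF true h = ⊥-elim (h (λ _ → refl))
    lemF false h = refl
    lemT : ∀ {X : Set} b → ¬ (b ≡ true → X) → b ≡ true
    lemT true h = refl
    lemT false h = ⊥-elim (h (λ ()))

  reach-shorten : ∀ k v → Ball k v ≡ true → Ball (n ∸ 1) v ≡ true
  reach-shorten k v e with stable-or-growing n
  ... | inj₂ c = ⊥-elim (<⇒≱ c (countFin-≤ (Ball n)))
  ... | inj₁ (j' , lt , st) = reach-mono A (≤-trans (≤-pred (subst (suc j' ≤_) (sym (suc-pred-≡ lt)) lt)) ≤-refl) (stable-everywhere j' st k v e)
    where
    suc-pred-≡ : ∀ {a b} → a < b → suc (b ∸ 1) ≡ b
    suc-pred-≡ {b = suc b} _ = refl

module _ {n : ℕ} (A : Adj n) where
  dist-≤ : ∀ k {u v} → reachWithin A k u v ≡ true → dist A u v ≤ k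
  dist-≤ k {u} {v} e with k <? n
  ... | yes lt = least-minimal (λ k → reachWithin A k u v) n k lt e
  ... | no ¬lt = ≤-trans (least-≤ _ n) (≮⇒≥ ¬lt)

  reach-dist : ∀ k {u v} → reachWithin A k u v ≡ true → reachWithin A (dist A u v) u v ≡ true
  reach-dist k {u} {v} e = least-sound (λ k → reachWithin A k u v) n (≤-trans (s≤s (least-minimal (λ k → reachWithin A k u v) n (n ∸ 1) (lt u) (Shortening.reach-shorten A u k v e))) (eqn u))
    where
    lt : Fin n → n ∸ 1 < n
    lt Fin.zero = ≤-refl
    lt (Fin.suc _) = ≤-refl
    eqn : Fin n → suc (n ∸ 1) ≤ n
    eqn Fin.zero = ≤-refl
    eqn (Fin.suc _) = ≤-refl

  dist-sym : (∀ a b → A a b ≡ A b a) → ∀ u v → dist A u v ≡ dist A v u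
  dist-sym Asym u v = least-cong _ _ n (λ j → beq (Sym.reach-sym A Asym j {u} {v}) (Sym.reach-sym A Asym j {v} {u}))
    where
    beq : ∀ {a b : Bool} → (a ≡ true → b ≡ true) → (b ≡ true → a ≡ true) → a ≡ b
    beq {true} f g = sym (f refl)
    beq {false} {true} f g = g refl
    beq {false} {false} f g = refl

  dist-refl : ∀ u → dist A u u ≡ 0
  dist-refl u = n≤0⇒n≡0 (dist-≤ 0 (reach-refl A u))

cycleEdge-intro : ∀ {n m} (c : Fin (suc m) → Fin n) i → cycleEdge c (c i) (c (next i)) ≡ true
cycleEdge-intro c i = anyFin-intro _ i (∨-trueˡ _ (∧-true (==-refl (c i)) (==-refl (c (next i)))))

module CycleSetup {n : ℕ} (G : Graph n) (g : ℕ) (c : Fin (suc g) → Fin n) where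
  L : ℕ
  L = suc g

  A = adj G
  Asym : ∀ a b → A a b ≡ A b a
  Asym = Graph.sym G

  cE : Fin n → Fin n → Bool
  cE = cycleEdge c

  cE-sym : ∀ a b → cE a b ≡ cE b a
  cE-sym a b = anyFin-cong (λ i → ((a == c i) ∧ (b == c (next i))) ∨ ((a == c (next i)) ∧ (b == c i)))
                          (λ i → ((b == c i) ∧ (a == c (next i))) ∨ ((b == c (next i)) ∧ (a == c i)))
                          (λ i → trans (∨-comm ((a == c i) ∧ (b == c (next i))) _) (cong₂ _∨_ (∧-comm (a == c (next i)) _) (∧-comm (a == c i) _)))

  F : Adj n
  F = minusCycle G c

  F-sym : ∀ a b → F a b ≡ F b a
  F-sym a b rewrite Asym a b | cE-sym a b = refl

  F⊆A : ∀ a b → F a b ≡ true → A a b ≡ true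
  F⊆A a b e = ∧-conicalˡ _ _ e

  F-notcE : ∀ a b → F a b ≡ true → cE a b ≡ false
  F-notcE a b e = not-true⇒false _ (∧-conicalʳ (A a b) _ e)

  F-intro : ∀ a b → A a b ≡ true → cE a b ≡ false → F a b ≡ true
  F-intro a b e f rewrite e | f = refl

  pos : ℕ → Fin n
  pos = at c

  %L : ∀ x → x < L → x % L ≡ x
  %L x lt = m<n⇒m%n≡m lt

  mod-toℕ : ∀ (i : Fin L) → toℕ i mod L ≡ i
  mod-toℕ i = toℕ-injective (trans (toℕ-fromℕ< _) (%L (toℕ i) (toℕ<n i)))

  pos-toℕ : ∀ (i : Fin L) → pos (toℕ i) ≡ c i
  pos-toℕ i = cong c (mod-toℕ i)

  toℕ-mod : ∀ x → x < L → toℕ (x mod L) ≡ x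
  toℕ-mod x lt = trans (toℕ-fromℕ< _) (%L x lt)

  next-mod : ∀ x → x < L → next (x mod L) ≡ suc x mod L
  next-mod x lt = toℕ-injective (trans (toℕ-fromℕ< _) (trans (cong (λ z → suc z % L) (toℕ-mod x lt)) (sym (toℕ-fromℕ< _))))

  module WithCycle (isC : IsCycle G c) where
    open IsCycle isC

    pos-inj : ∀ x y → x < L → y < L → pos x ≡ pos y → x ≡ y
    pos-inj x y lx ly e = trans (sym (toℕ-mod x lx)) (trans (cong toℕ (injective e)) (toℕ-mod y ly))

    pos-adj : ∀ x → x < L → A (pos x) (pos (suc x)) ≡ true
    pos-adj x lt = subst (λ z → A (pos x) (c z) ≡ true) (next-mod x lt) (adjacent (x mod L))

    pos-cE : ∀ x → x < L → cE (pos x) (pos (suc x)) ≡ true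
    pos-cE x lt = subst (λ z → cE (pos x) (c z) ≡ true) (next-mod x lt) (cycleEdge-intro c (x mod L))

    cE-inv : ∀ a b → cE a b ≡ true → ∃[ x ] (x < L × ((a ≡ pos x × b ≡ pos (suc x)) ⊎ (b ≡ pos x × a ≡ pos (suc x))))
    cE-inv a b e with anyFin⇒∃ _ e
    ... | i , q = toℕ i , toℕ<n i , lem (∨-true⁻ _ _ q)
      where
      eq1 : c i ≡ pos (toℕ i)
      eq1 = sym (pos-toℕ i)
      eq2 : c (next i) ≡ pos (suc (toℕ i))
      eq2 = cong c (trans (sym (cong next (mod-toℕ i))) (next-mod (toℕ i) (toℕ<n i)))
      lem : ((a == c i) ∧ (b == c (next i))) ≡ true ⊎ ((a == c (next i)) ∧ (b == c i)) ≡ true → _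
      lem (inj₁ r) = inj₁ (trans (==⇒≡ (∧-conicalˡ _ _ r)) eq1 , trans (==⇒≡ (∧-conicalʳ (a == c i) _ r)) eq2)
      lem (inj₂ r) = inj₂ (trans (==⇒≡ (∧-conicalʳ (a == c (next i)) _ r)) eq1 , trans (==⇒≡ (∧-conicalˡ _ _ r)) eq2)

m∸n≡suc[m∸suc[n]] : ∀ m n → n < m → m ∸ n ≡ suc (m ∸ suc n)
m∸n≡suc[m∸suc[n]] (suc m) zero _ = refl
m∸n≡suc[m∸suc[n]] (suc m) (suc n) (s≤s lt) = m∸n≡suc[m∸suc[n]] m n lt

OnlyCycle : ∀ {n} (G : Graph n) {g} → (Fin (suc g) → Fin n) → Set
OnlyCycle G c = ∀ m c′ → IsCycle G {m} c′ → ∀ a b → cycleEdge c′ a b ≡ cycleEdge c a b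

module UniqueCycle {n : ℕ} (G : Graph n) (g : ℕ) (c : Fin (suc g) → Fin n) (isC : IsCycle G c)
  (uniq : OnlyCycle G c) where
  open CycleSetup G g c
  open WithCycle isC
  RF = reachWithin F

  -- Follow a shortest F-walk from pos lo to pos hi (its interior avoids the cycle, since no shorter
  -- F-walk joins two cycle positions), then return along the cycle arc from hi down to lo: this is
  -- a cycle of G whose first edge is not an edge of c.
  module SecondCycle (t' lo d' : ℕ) (hiL : lo + suc d' < L)
     (Rt : RF (suc t') (pos (lo + suc d')) (pos lo) ≡ true)
     (minP : ∀ t → t < suc t' → ∀ x y → x < L → y < L → ¬ x ≡ y → RF t (pos x) (pos y) ≡ false) where
    T* = suc t'
    hi = lo + suc d'
    src = pos hi
    N = suc t' + suc d'
    m' = t' + suc d'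

    lo<hi : lo < hi
    lo<hi = ≤-trans (n<1+n lo) (subst (suc lo ≤_) (sym (+-suc lo d')) (s≤s (m≤m+n lo d')))
    loL : lo < L
    loL = <-trans lo<hi hiL

    ExactDist : ℕ → Fin n → Set
    ExactDist s x = RF s src x ≡ true × (∀ s' → s' < s → RF s' src x ≡ false)

    ExactDist-unique : ∀ {s s' x} → ExactDist s x → ExactDist s' x → s ≡ s'
    ExactDist-unique {s} {s'} (a , b) (a' , b') with <-cmp s s'
    ... | tri< lt _ _ = ⊥-elim (true≢false a (b' s lt))
    ... | tri≈ _ eq _ = eq
    ... | tri> _ _ gt = ⊥-elim (true≢false a' (b s' gt))

    predecessor? : (s : ℕ) (x : Fin n) → Dec (∃ λ w → (RF s src w ∧ F w x) ≡ true)
    predecessor? s x = any? (λ w → ≡true? (RF s src w ∧ F w x))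

    predecessor : ℕ → Fin n → Fin n
    predecessor s x with predecessor? s x
    ... | yes (w , _) = w
    ... | no _ = x

    predecessor-spec : ∀ s x → (∃ λ w → (RF s src w ∧ F w x) ≡ true) → (RF s src (predecessor s x) ∧ F (predecessor s x) x) ≡ true
    predecessor-spec s x ex with predecessor? s x
    ... | yes (w , p) = p
    ... | no ¬p = ⊥-elim (¬p ex)

    predecessor-exact : ∀ s x → ExactDist (suc s) x → ExactDist s (predecessor s x) × F (predecessor s x) x ≡ true
    predecessor-exact s x (r , shorter-miss) with reach-suc⁻ F s r
    ... | inj₁ q = ⊥-elim (true≢false q (shorter-miss s ≤-refl))
    ... | inj₂ (w , q , a) = (R1 , low) , ∧-conicalʳ (RF s src (predecessor s x)) _ sp
      where
      sp = predecessor-spec s x (w , ∧-true q a)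
      R1 = ∧-conicalˡ _ _ sp
      low : ∀ s' → s' < s → RF s' src (predecessor s x) ≡ false
      low s' lt = ¬true⇒false _ (λ e → true≢false (reach-snoc F s' e (∧-conicalʳ (RF s src (predecessor s x)) _ sp)) (shorter-miss (suc s') (s≤s lt)))

    geodesic : ℕ → Fin n
    geodesic zero = pos lo
    geodesic (suc j) = predecessor (T* ∸ suc j) (geodesic j)

    geodesic-exact : ∀ j → j ≤ T* → ExactDist (T* ∸ j) (geodesic j)
    geodesic-exact zero _ = Rt , (λ s' lt → minP s' lt hi lo hiL loL (λ e → <-irrefl (sym e) lo<hi))
    geodesic-exact (suc j) le = proj₁ (predecessor-exact (T* ∸ suc j) (geodesic j) (subst (λ z → ExactDist z (geodesic j)) (m∸n≡suc[m∸suc[n]] T* j le) (geodesic-exact j (≤-trans (n≤1+n j) le))))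

    geodesic-edge : ∀ j → suc j ≤ T* → F (geodesic (suc j)) (geodesic j) ≡ true
    geodesic-edge j le = proj₂ (predecessor-exact (T* ∸ suc j) (geodesic j) (subst (λ z → ExactDist z (geodesic j)) (m∸n≡suc[m∸suc[n]] T* j le) (geodesic-exact j (≤-trans (n≤1+n j) le))))

    ExactDist-src : ExactDist 0 src
    ExactDist-src = reach-refl F src , (λ s' ())

    geodesic-end : geodesic T* ≡ src
    geodesic-end = sym (reach-zero⇒≡ F {src} {geodesic T*} (subst (λ z → RF z src (geodesic T*) ≡ true) (n∸n≡0 T*) (proj₁ (geodesic-exact T* ≤-refl))))

    geodesic-on-cycle : ∀ j r → j ≤ T* → r < L → geodesic j ≡ pos r → (j ≡ 0 × r ≡ lo) ⊎ (j ≡ T* × r ≡ hi)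
    geodesic-on-cycle j r le rL e with r ≟ℕ hi
    ... | yes rh = inj₂ (j≡ , rh)
      where
      el : ExactDist (T* ∸ j) src
      el = subst (ExactDist (T* ∸ j)) (trans e (cong pos rh)) (geodesic-exact j le)
      j≡ : j ≡ T*
      j≡ = trans (sym (m∸[m∸n]≡n {T*} {j} le)) (cong (T* ∸_) (ExactDist-unique el ExactDist-src))
    ... | no rh with T* ∸ j <? T*
    ... | yes lt = ⊥-elim (true≢false (subst (λ z → RF (T* ∸ j) src z ≡ true) e (proj₁ (geodesic-exact j le))) (minP (T* ∸ j) lt hi r hiL rL (λ q → rh (sym q))))
    ... | no nlt = inj₁ (j0 , sym (pos-inj lo r loL rL (trans (cong geodesic (sym j0)) (trans (cong geodesic j0) (subst (λ z → geodesic z ≡ pos r) j0 e)))))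
      where
      j0 : j ≡ 0
      j0 = lemma j (≮⇒≥ nlt)
        where
        lemma : ∀ j → T* ≤ T* ∸ j → j ≡ 0
        lemma zero _ = refl
        lemma (suc j) h = ⊥-elim (<⇒≱ (s≤s (m∸n≤m t' j)) h)

    closedWalk : ℕ → Fin n
    closedWalk i with i ≤? T*
    ... | yes _ = geodesic i
    ... | no _ = pos (hi ∸ (i ∸ T*))

    closedWalk-geodesic : ∀ i → i ≤ T* → closedWalk i ≡ geodesic i
    closedWalk-geodesic i le with i ≤? T*
    ... | yes _ = refl
    ... | no ¬p = ⊥-elim (¬p le)

    closedWalk-arc : ∀ e → closedWalk (T* + e) ≡ pos (hi ∸ e)
    closedWalk-arc e with T* + e ≤? T*
    closedWalk-arc zero | yes _ = trans (cong geodesic (+-identityʳ T*)) geodesic-end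
    closedWalk-arc (suc e) | yes le = ⊥-elim (<⇒≱ (subst (T* <_) (sym (+-suc T* e)) (s≤s (m≤m+n T* e))) le)
    closedWalk-arc e | no _ = cong (λ z → pos (hi ∸ z)) (m+n∸m≡n T* e)

    past-geodesic : ∀ j → ¬ (j ≤ T*) → ∃[ e ] (j ≡ T* + suc e)
    past-geodesic j nle = j ∸ suc T* , sym (trans (+-suc T* (j ∸ suc T*)) (m+[n∸m]≡n {suc T*} {j} (≰⇒> nle)))

    arc-position : ∀ e → e < d' → hi ∸ suc e ≡ lo + suc (d' ∸ suc e)
    arc-position e lt = trans (+-∸-assoc lo {suc d'} {suc e} (s≤s (<⇒≤ lt))) (cong (lo +_) (m∸n≡suc[m∸suc[n]] d' e lt))

    not-digon : ¬ (t' ≡ 0 × d' ≡ 0)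
    not-digon (refl , refl) = true≢false (pos-cE lo loL) (trans (cE-sym (pos lo) (pos (suc lo))) (F-notcE _ _ Fe))
      where
      Fe : F (pos (suc lo)) (pos lo) ≡ true
      Fe = subst (λ z → F z (pos lo) ≡ true) (trans geodesic-end (cong pos (+-comm lo 1))) (geodesic-edge 0 ≤-refl)

    3≤N : 3 ≤ N
    3≤N = lem t' d' not-digon
      where
      lem : ∀ a b → ¬ (a ≡ 0 × b ≡ 0) → 3 ≤ suc a + suc b
      lem zero zero h = ⊥-elim (h (refl , refl))
      lem zero (suc b) h = s≤s (s≤s (s≤s z≤n))
      lem (suc a) b h = s≤s (s≤s (subst (1 ≤_) (sym (+-suc a b)) (s≤s z≤n)))

    closedWalk-arc-adjacent : ∀ e → e < d' → A (closedWalk (T* + e)) (closedWalk (T* + suc e)) ≡ true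
    closedWalk-arc-adjacent e lt rewrite closedWalk-arc e | closedWalk-arc (suc e) | m∸n≡suc[m∸suc[n]] hi e (<-trans lt (m≤n+m (suc d') lo)) =
      trans (Asym _ _) (pos-adj (hi ∸ suc e) (≤-trans (s≤s (m∸n≤m hi (suc e))) hiL))

    closedWalk-adjacent : ∀ j → suc j < N → A (closedWalk j) (closedWalk (suc j)) ≡ true
    closedWalk-adjacent j lt = h (suc j ≤? T*)
      where
      h : Dec (suc j ≤ T*) → A (closedWalk j) (closedWalk (suc j)) ≡ true
      h (yes le) rewrite closedWalk-geodesic j (≤-trans (n≤1+n j) le) | closedWalk-geodesic (suc j) le = trans (Asym _ _) (F⊆A _ _ (geodesic-edge j le))
      h (no nle) with past-geodesic (suc j) nle
      ... | e , eq = subst₂ (λ a b → A (closedWalk a) (closedWalk b) ≡ true) (sym j≡) (sym eq) (closedWalk-arc-adjacent e e<)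
        where
        j≡ : j ≡ T* + e
        j≡ = suc-injective (trans eq (+-suc T* e))
        e< : e < d'
        e< = ≤-pred (+-cancelˡ-< T* (suc e) (suc d') (subst (_< T* + suc d') eq lt))

    closedWalk-closes : A (closedWalk m') (closedWalk 0) ≡ true
    closedWalk-closes rewrite closedWalk-geodesic 0 z≤n = subst (λ z → A (closedWalk z) (pos lo) ≡ true) (sym (+-suc t' d'))
       (subst (λ z → A z (pos lo) ≡ true) (sym (closedWalk-arc d'))
         (subst (λ z → A (pos z) (pos lo) ≡ true) (sym hd) (trans (Asym _ _) (pos-adj lo loL))))
      where
      hd : hi ∸ d' ≡ suc lo
      hd = trans (+-∸-assoc lo {suc d'} {d'} (n≤1+n d')) (trans (cong (lo +_) (m+n∸n≡m 1 d')) (+-comm lo 1))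

    ∸-suc-< : ∀ a b → 0 < a → a ∸ suc b < a
    ∸-suc-< (suc a) b _ = s≤s (m∸n≤m a b)

    arc-index< : ∀ j e → j < N → j ≡ T* + suc e → e < d'
    arc-index< j e jN eq = ≤-pred (+-cancelˡ-< T* (suc e) (suc d') (subst (_< T* + suc d') eq jN))

    closedWalk-injective-< : ∀ i j → i < j → j < N → closedWalk i ≡ closedWalk j → ⊥
    closedWalk-injective-< i j lt jN e = h (j ≤? T*)
      where
      h : Dec (j ≤ T*) → ⊥
      h (yes jle) = <-irrefl (∸-cancelˡ-≡ ile jle (ExactDist-unique elI elJ)) lt
        where
        ile = ≤-trans (<⇒≤ lt) jle
        zij : geodesic i ≡ geodesic j
        zij = trans (sym (closedWalk-geodesic i ile)) (trans e (closedWalk-geodesic j jle))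
        elI : ExactDist (T* ∸ i) (geodesic j)
        elI = subst (ExactDist (T* ∸ i)) zij (geodesic-exact i ile)
        elJ = geodesic-exact j jle
      h (no jnle) with past-geodesic j jnle
      ... | ej , eqj = h2 (i ≤? T*)
        where
        ed = arc-index< j ej jN eqj
        y = d' ∸ suc ej
        x = lo + suc y
        hx : hi ∸ suc ej ≡ x
        hx = arc-position ej ed
        y<d : y < d'
        y<d = ∸-suc-< d' ej (≤-trans (s≤s z≤n) ed)
        x<hi : x < hi
        x<hi = +-monoʳ-< lo (s≤s y<d)
        xL : x < L
        xL = <-trans x<hi hiL
        cj : closedWalk j ≡ pos x
        cj = trans (cong closedWalk eqj) (trans (closedWalk-arc (suc ej)) (cong pos hx))
        h2 : Dec (i ≤ T*) → ⊥
        h2 (yes ile) with geodesic-on-cycle i x ile xL (trans (sym (closedWalk-geodesic i ile)) (trans e cj))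
        ... | inj₁ (_ , xlo) = <-irrefl (sym xlo) (subst (lo <_) (sym (+-suc lo y)) (s≤s (m≤m+n lo y)))
        ... | inj₂ (_ , xhi) = <-irrefl xhi x<hi
        h2 (no inle) with past-geodesic i inle
        ... | ei , eqi = <-irrefl ij lt
          where
          edi = arc-index< i ei (<-trans lt jN) eqi
          hle : ∀ e → e < d' → suc e ≤ hi
          hle e l = ≤-trans (<⇒≤ (s≤s l)) (m≤n+m (suc d') lo)
          pe : pos (hi ∸ suc ei) ≡ pos (hi ∸ suc ej)
          pe = trans (sym (closedWalk-arc (suc ei))) (trans (cong closedWalk (sym eqi)) (trans e (trans (cong closedWalk eqj) (closedWalk-arc (suc ej)))))
          ee : suc ei ≡ suc ej
          ee = ∸-cancelˡ-≡ (hle ei edi) (hle ej ed) (pos-inj _ _ (≤-trans (s≤s (m∸n≤m hi (suc ei))) hiL) (≤-trans (s≤s (m∸n≤m hi (suc ej))) hiL) pe)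
          ij : i ≡ j
          ij = trans eqi (trans (cong (T* +_) ee) (sym eqj))

    closedWalk-injective : ∀ i j → i < N → j < N → closedWalk i ≡ closedWalk j → i ≡ j
    closedWalk-injective i j iN jN e with <-cmp i j
    ... | tri< lt _ _ = ⊥-elim (closedWalk-injective-< i j lt jN e)
    ... | tri≈ _ eq _ = eq
    ... | tri> _ _ gt = ⊥-elim (closedWalk-injective-< j i gt iN (sym e))

    c′ : Fin (suc m') → Fin n
    c′ i = closedWalk (toℕ i)

    next-val : ∀ (i : Fin (suc m')) → toℕ (next i) ≡ suc (toℕ i) % N
    next-val i = toℕ-fromℕ< _

    c′-adjacent : ∀ i → A (c′ i) (c′ (next i)) ≡ true
    c′-adjacent i = h (suc (toℕ i) <? N)
      where
      h : Dec (suc (toℕ i) < N) → A (c′ i) (c′ (next i)) ≡ true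
      h (yes lt) = subst (λ z → A (c′ i) (closedWalk z) ≡ true) (sym (trans (next-val i) (m<n⇒m%n≡m lt))) (closedWalk-adjacent (toℕ i) lt)
      h (no nlt) = subst₂ (λ a b → A (closedWalk a) (closedWalk b) ≡ true) (sym ti) (sym (trans (next-val i) (trans (cong (λ z → suc z % N) ti) (n%n≡0 N)))) closedWalk-closes
        where
        ti : toℕ i ≡ m'
        ti = ≤-antisym (≤-pred (toℕ<n i)) (≤-pred (≮⇒≥ nlt))

    isCycle′ : IsCycle G c′
    isCycle′ = record { length≥3 = 3≤N ; injective = λ {i} {j} e → toℕ-injective (closedWalk-injective _ _ (toℕ<n i) (toℕ<n j) e) ; adjacent = c′-adjacent }

    absurd : ⊥
    absurd = true≢false lhs (trans (uniq m' c′ isCycle′ (geodesic 0) (geodesic 1)) rhs)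
      where
      one : toℕ (next {m'} Fin.zero) ≡ 1
      one = trans (next-val Fin.zero) (m<n⇒m%n≡m {N} {1} (≤-trans (s≤s (s≤s z≤n)) 3≤N))
      lhs : cycleEdge c′ (geodesic 0) (geodesic 1) ≡ true
      lhs = subst₂ (λ a b → cycleEdge c′ a b ≡ true) (closedWalk-geodesic 0 z≤n)
              (trans (cong closedWalk one) (closedWalk-geodesic 1 (s≤s z≤n))) (cycleEdge-intro c′ Fin.zero)
      rhs : cycleEdge c (geodesic 0) (geodesic 1) ≡ false
      rhs = trans (cE-sym (geodesic 0) (geodesic 1)) (F-notcE _ _ (geodesic-edge 0 (s≤s z≤n)))

  NoShorterWalk : ℕ → Set
  NoShorterWalk t* = ∀ t → t < t* → ∀ x y → x < L → y < L → ¬ x ≡ y → RF t (pos x) (pos y) ≡ false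

  minimal-walk-absurd : ∀ t lo hi → lo < hi → hi < L → RF t (pos hi) (pos lo) ≡ true → NoShorterWalk t → ⊥
  minimal-walk-absurd zero lo hi lt hiL r _ = <-irrefl (sym (pos-inj hi lo hiL (<-trans lt hiL) (reach-zero⇒≡ F {pos hi} {pos lo} r))) lt
  minimal-walk-absurd (suc t') lo hi lt hiL r mp = SecondCycle.absurd t' lo (hi ∸ suc lo) hiL' r' mp
    where
    eqh : lo + suc (hi ∸ suc lo) ≡ hi
    eqh = trans (+-suc lo (hi ∸ suc lo)) (m+[n∸m]≡n lt)
    hiL' = subst (_< L) (sym eqh) hiL
    r' = subst (λ z → RF (suc t') (pos z) (pos lo) ≡ true) (sym eqh) r

  SomePairReached : ℕ → Bool
  SomePairReached t = anyFin (λ (a : Fin L) → anyFin (λ (b : Fin L) → not (a == b) ∧ RF t (c a) (c b)))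

  FsymR = Sym.reach-sym F F-sym

  -- Take the least length of an F-walk joining two distinct cycle positions, and apply SecondCycle.
  cycle-positions-separated : ∀ x y k → x < L → y < L → RF k (pos x) (pos y) ≡ true → x ≡ y
  cycle-positions-separated x y k xL yL r with x ≟ℕ y
  ... | yes eq = eq
  ... | no ne = ⊥-elim contra
    where
    P0 : SomePairReached k ≡ true
    P0 = anyFin-intro _ (x mod L) (anyFin-intro _ (y mod L)
           (∧-true (false⇒not-true _ (≢⇒==-false (λ q → ne (trans (sym (toℕ-mod x xL)) (trans (cong toℕ q) (toℕ-mod y yL)))))) r))
    t* = least SomePairReached (suc k)
    t*< : t* < suc k
    t*< = s≤s (least-minimal SomePairReached (suc k) k ≤-refl P0)
    Pt : SomePairReached t* ≡ true
    Pt = least-sound SomePairReached (suc k) t*<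
    mp : NoShorterWalk t*
    mp t lt x' y' xL' yL' ne' = ¬true⇒false _ (λ q → true≢false (∧-true (false⇒not-true _ (≢⇒==-false (λ w → ne' (trans (sym (toℕ-mod x' xL')) (trans (cong toℕ w) (toℕ-mod y' yL')))))) q)
         (anyFin-false _ (anyFin-false _ (least-below SomePairReached (suc k) t lt) (x' mod L)) (y' mod L)))
    contra : ⊥
    contra with anyFin⇒∃ _ Pt
    ... | a , pa with anyFin⇒∃ _ pa
    ... | b , pb = h (<-cmp (toℕ a) (toℕ b))
      where
      nab : ¬ a ≡ b
      nab q = true≢false (∧-conicalˡ _ _ pb) (subst (λ z → not (a == z) ≡ false) q (cong not (==-refl a)))
      rab : RF t* (pos (toℕ a)) (pos (toℕ b)) ≡ true
      rab = subst₂ (λ u v → RF t* u v ≡ true) (sym (pos-toℕ a)) (sym (pos-toℕ b)) (∧-conicalʳ (not (a == b)) _ pb)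
      h : Tri (toℕ a < toℕ b) (toℕ a ≡ toℕ b) (toℕ b < toℕ a) → ⊥
      h (tri< lt _ _) = minimal-walk-absurd t* (toℕ a) (toℕ b) lt (toℕ<n b) (FsymR t* rab) mp
      h (tri≈ _ eq _) = nab (toℕ-injective eq)
      h (tri> _ _ gt) = minimal-walk-absurd t* (toℕ b) (toℕ a) gt (toℕ<n a) rab mp

-- Trees attached to the cycle

∣m∸o-n∸o∣≡∣m-n∣ : ∀ o m n → o ≤ m → o ≤ n → ∣ m ∸ o - n ∸ o ∣ ≡ ∣ m - n ∣
∣m∸o-n∸o∣≡∣m-n∣ zero m n _ _ = refl
∣m∸o-n∸o∣≡∣m-n∣ (suc o) (suc m) (suc n) (s≤s p) (s≤s q) = ∣m∸o-n∸o∣≡∣m-n∣ o m n p q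

[o∸m]∸[n∸m]≡o∸n : ∀ m n o → m ≤ n → n ≤ o → (o ∸ m) ∸ (n ∸ m) ≡ o ∸ n
[o∸m]∸[n∸m]≡o∸n zero n o _ _ = refl
[o∸m]∸[n∸m]≡o∸n (suc m) (suc n) (suc o) (s≤s p) (s≤s q) = [o∸m]∸[n∸m]≡o∸n m n o p q

Lip : ℕ → ℕ → Set
Lip a b = a ≤ suc b × b ≤ suc a

lip-+ˡ : ∀ c {a b} → Lip a b → Lip (c + a) (c + b)
lip-+ˡ c {a} {b} (p , q) = ≤-trans (+-monoʳ-≤ c p) (≤-reflexive (+-suc c b)) , ≤-trans (+-monoʳ-≤ c q) (≤-reflexive (+-suc c a))

∣n-suc[n]∣≡1 : ∀ s → ∣ s - suc s ∣ ≡ 1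
∣n-suc[n]∣≡1 zero = refl
∣n-suc[n]∣≡1 (suc s) = ∣n-suc[n]∣≡1 s

lip-abs : ∀ ρ s → Lip ∣ ρ - suc s ∣ ∣ ρ - s ∣
lip-abs ρ s = ≤-trans (∣-∣-triangle ρ s (suc s)) (≤-reflexive (trans (cong (∣ ρ - s ∣ +_) (∣n-suc[n]∣≡1 s)) (+-comm _ 1))) ,
              ≤-trans (∣-∣-triangle ρ (suc s) s) (≤-reflexive (trans (cong (∣ ρ - suc s ∣ +_) (trans (∣-∣-comm (suc s) s) (∣n-suc[n]∣≡1 s))) (+-comm _ 1)))

∸-lip-≤ : ∀ L a b → a ≤ suc b → L ∸ b ≤ suc (L ∸ a)
∸-lip-≤ zero a b _ = subst (_≤ suc (0 ∸ a)) (sym (0∸n≡0 b)) z≤n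
∸-lip-≤ (suc L) zero zero _ = n≤1+n _
∸-lip-≤ (suc L) (suc zero) zero _ = ≤-refl
∸-lip-≤ (suc L) (suc (suc a)) zero (s≤s ())
∸-lip-≤ (suc L) zero (suc b) _ = ≤-trans (m∸n≤m L b) (≤-trans (n≤1+n L) (n≤1+n _))
∸-lip-≤ (suc L) (suc a) (suc b) (s≤s p) = ∸-lip-≤ L a b p

lip-∸ : ∀ L {a b} → Lip a b → Lip (L ∸ a) (L ∸ b)
lip-∸ L {a} {b} (p , q) = ∸-lip-≤ L b a q , ∸-lip-≤ L a b p

⊓-≤-either : ∀ a b x → a ≤ x ⊎ b ≤ x → a ⊓ b ≤ x
⊓-≤-either a b x (inj₁ p) = ≤-trans (m⊓n≤m a b) p
⊓-≤-either a b x (inj₂ p) = ≤-trans (m⊓n≤n a b) p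

⊓-lip-≤ : ∀ {a b a' b'} → a ≤ suc b → a' ≤ suc b' → a ⊓ a' ≤ suc (b ⊓ b')
⊓-lip-≤ {a} {b} {a'} {b'} p q with ⊓-sel b b'
... | inj₁ e = ⊓-≤-either a a' _ (inj₁ (subst (λ z → a ≤ suc z) (sym e) p))
... | inj₂ e = ⊓-≤-either a a' _ (inj₂ (subst (λ z → a' ≤ suc z) (sym e) q))

lip-⊓ : ∀ {a b a' b'} → Lip a b → Lip a' b' → Lip (a ⊓ a') (b ⊓ b')
lip-⊓ (p , q) (p' , q') = ⊓-lip-≤ p p' , ⊓-lip-≤ q q'

wrap-≤ : ∀ ρ a → ρ ⊓ suc a ≤ suc (a ⊓ suc ρ)
wrap-≤ ρ a with ⊓-sel a (suc ρ)
... | inj₁ e = subst (λ z → ρ ⊓ suc a ≤ suc z) (sym e) (m⊓n≤n ρ (suc a))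
... | inj₂ e = subst (λ z → ρ ⊓ suc a ≤ suc z) (sym e) (≤-trans (m⊓n≤m ρ (suc a)) (≤-trans (n≤1+n ρ) (n≤1+n _)))

lip-wrap : ∀ ρ a → Lip (ρ ⊓ suc a) (a ⊓ suc ρ)
lip-wrap ρ a = wrap-≤ ρ a , wrap-≤ a ρ

module Roots {n : ℕ} (G : Graph n) (g : ℕ) (c : Fin (suc g) → Fin n) (isC : IsCycle G c)
  (uniq : OnlyCycle G c)
  (conn : Connected (adj G)) where
  open CycleSetup G g c
  open WithCycle isC
  open UniqueCycle G g c isC uniq

  RA = reachWithin A
  FRsym = Sym.reach-sym F F-sym

  nrm : ℕ → ℕ
  nrm z = toℕ (z mod L)

  nrm< : ∀ z → nrm z < L
  nrm< z = toℕ<n (z mod L)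

  pos-nrm : ∀ z → pos (nrm z) ≡ pos z
  pos-nrm z = pos-toℕ (z mod L)

  reach-F-within-n : ∀ k {u v} → RF k u v ≡ true → RF n u v ≡ true
  reach-F-within-n k {u} {v} e = reach-mono F (m∸n≤m n 1) (Shortening.reach-shorten F u k v e)

  reaches-cycle : ∀ k v → RA k (pos 0) v ≡ true → ∃[ p ] (p < L × ∃[ j ] RF j (pos p) v ≡ true)
  reaches-cycle zero v e = 0 , s≤s z≤n , 0 , subst (λ z → RF 0 (pos 0) z ≡ true) (reach-zero⇒≡ A {pos 0} {v} e) (reach-refl F (pos 0))
  reaches-cycle (suc k) v e with reach-suc⁻ A k e
  ... | inj₁ q = reaches-cycle k v q
  ... | inj₂ (w , q , a) with cE w v in eq
  ... | false with reaches-cycle k w q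
  ...   | p , pL , j , walk = p , pL , suc j , reach-snoc F j walk (F-intro w v a eq)
  reaches-cycle (suc k) v e | inj₂ (w , q , a) | true with cE-inv w v eq
  ... | x , xL , inj₁ (_ , vx) = nrm (suc x) , nrm< (suc x) , 0 , subst (λ z → RF 0 (pos (nrm (suc x))) z ≡ true) (trans (pos-nrm (suc x)) (sym vx)) (reach-refl F (pos (nrm (suc x))))
  ... | x , xL , inj₂ (vx , _) = x , xL , 0 , subst (λ z → RF 0 (pos x) z ≡ true) (sym vx) (reach-refl F (pos x))

  root : Fin n → ℕ
  root v = least (λ p → RF n (pos p) v) L

  root-spec : ∀ v → root v < L × RF n (pos (root v)) v ≡ true
  root-spec v with conn (pos 0) v
  ... | k , e with reaches-cycle k v e
  ... | p , pL , j , rr = lt , least-sound (λ p → RF n (pos p) v) L lt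
    where
    lt : root v < L
    lt = ≤-trans (s≤s (least-minimal (λ p → RF n (pos p) v) L p pL (reach-F-within-n j rr))) pL

  root< : ∀ v → root v < L
  root< v = proj₁ (root-spec v)

  root-reaches : ∀ v → RF n (pos (root v)) v ≡ true
  root-reaches v = proj₂ (root-spec v)

  root-unique : ∀ p j v → p < L → RF j (pos p) v ≡ true → root v ≡ p
  root-unique p j v pL e = cycle-positions-separated (root v) p (n + j) (root< v) pL (reach-++ F n j (root-reaches v) (FRsym j e))

  root-cycle : ∀ z → root (pos z) ≡ nrm z
  root-cycle z = root-unique (nrm z) 0 (pos z) (nrm< z) (subst (λ w → RF 0 (pos (nrm z)) w ≡ true) (pos-nrm z) (reach-refl F (pos (nrm z))))

  root-F-edge : ∀ a b → F a b ≡ true → root b ≡ root a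
  root-F-edge a b e = root-unique (root a) (suc n) b (root< a) (reach-snoc F n (root-reaches a) e)

  dF = dist F

  depth : Fin n → ℕ
  depth v = dF (pos (root v)) v

  depth-cycle : ∀ z → depth (pos z) ≡ 0
  depth-cycle z = n≤0⇒n≡0 (dist-≤ F 0 (subst₂ (λ a b → RF 0 a b ≡ true) (sym (trans (cong pos (root-cycle z)) (pos-nrm z))) refl (reach-refl F (pos z))))

  same-root-reach : ∀ v y → root y ≡ root v → RF (n + n) v y ≡ true
  same-root-reach v y eq = reach-++ F n n (FRsym n (root-reaches v)) (subst (λ z → RF n (pos z) y ≡ true) eq (root-reaches y))

  nx : ℕ → ℕ
  nx x = nrm (suc x)

  -- Distances in any symmetric B with F ⊆ B ⊆ A, given the distances D between cycle positions
  -- in B: the upper bounds are explicit walks; the lower bound holds because the claimed distance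
  -- from v, the potential ψ below, grows by at most one along each edge of B.
  module DistanceFormula (B : Adj n) (B-sym : ∀ a b → B a b ≡ B b a)
    (B⊆A : ∀ a b → B a b ≡ true → A a b ≡ true) (F⊆B : ∀ a b → F a b ≡ true → B a b ≡ true)
    (D : ℕ → ℕ → ℕ) (D-refl : ∀ p → D p p ≡ 0)
    (D-lip : ∀ x → x < L → B (pos x) (pos (suc x)) ≡ true → ∀ ρ → ρ < L → Lip (D ρ (nx x)) (D ρ x))
    (D-walk : ∀ p q → p < L → q < L → reachWithin B (D p q) (pos p) (pos q) ≡ true) where

    RB = reachWithin B

    module Potential (v : Fin n) where
      ρ = root v

      ψ' : (y : Fin n) → Dec (root y ≡ ρ) → ℕ
      ψ' y (yes _) = dF v y
      ψ' y (no _) = depth v + D ρ (root y) + depth y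

      ψ : Fin n → ℕ
      ψ y = ψ' y (root y ≟ℕ ρ)

      ψ-same : ∀ y → root y ≡ ρ → ψ y ≡ dF v y
      ψ-same y e with root y ≟ℕ ρ
      ... | yes _ = refl
      ... | no ne = ⊥-elim (ne e)

      ψ-diff : ∀ y → ¬ root y ≡ ρ → ψ y ≡ depth v + D ρ (root y) + depth y
      ψ-diff y ne with root y ≟ℕ ρ
      ... | yes e = ⊥-elim (ne e)
      ... | no _ = refl

      depth-sym : dF v (pos ρ) ≡ depth v
      depth-sym = dist-sym F F-sym v (pos ρ)

      ψ-cyc : ∀ z → ψ (pos z) ≡ depth v + D ρ (nrm z)
      ψ-cyc z with root (pos z) ≟ℕ ρ
      ... | yes e = trans (cong (dF v) (trans (sym (pos-nrm z)) (cong pos (trans (sym (root-cycle z)) e)))) (trans depth-sym (trans (sym (+-identityʳ (depth v))) (cong (depth v +_) (trans (sym (D-refl ρ)) (cong (D ρ) (trans (sym e) (root-cycle z)))))))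
      ... | no _ = trans (cong (λ w → depth v + D ρ (root (pos z)) + w) (depth-cycle z)) (trans (+-identityʳ _) (cong (λ w → depth v + D ρ w) (root-cycle z)))

      dF-step : ∀ a y z → RF (n + n) a y ≡ true → F y z ≡ true → dF a z ≤ suc (dF a y)
      dF-step a y z ra e = dist-≤ F (suc (dF a y)) (reach-snoc F (dF a y) (reach-dist F (n + n) ra) e)

      ψ-cycle-lip : ∀ x → x < L → B (pos x) (pos (suc x)) ≡ true → Lip (ψ (pos (suc x))) (ψ (pos x))
      ψ-cycle-lip x xL e = subst₂ Lip (sym (ψ-cyc (suc x))) (sym (trans (ψ-cyc x) (cong (λ w → depth v + D ρ w) (toℕ-mod x xL))))
                      (lip-+ˡ (depth v) (D-lip x xL e ρ (root< v)))

      ψ-lip : ∀ y z → B y z ≡ true → ψ z ≤ suc (ψ y)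
      ψ-lip y z e with cE y z in eq
      ... | false = lipF (F-intro y z (B⊆A y z e) eq)
        where
        lipF : F y z ≡ true → ψ z ≤ suc (ψ y)
        lipF f with root y ≟ℕ ρ
        ... | yes ry rewrite ψ-same z (trans (root-F-edge y z f) ry) = dF-step v y z (same-root-reach v y ry) f
        ... | no ry rewrite ψ-diff z (λ q → ry (trans (sym (root-F-edge y z f)) q)) =
              ≤-trans (+-mono-≤ (≤-reflexive (cong (λ w → depth v + D ρ w) (root-F-edge y z f))) hz) (≤-reflexive (+-suc (depth v + D ρ (root y)) (depth y)))
          where
          hz : depth z ≤ suc (depth y)
          hz = subst (λ w → dF (pos w) z ≤ suc (depth y)) (sym (root-F-edge y z f)) (dF-step (pos (root y)) y z (reach-mono F (m≤m+n n n) (root-reaches y)) f)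
      ... | true with cE-inv y z eq
      ...   | x , xL , inj₁ (yx , zx) = subst₂ (λ a b → ψ b ≤ suc (ψ a)) (sym yx) (sym zx) (proj₁ (ψ-cycle-lip x xL (subst₂ (λ a b → B a b ≡ true) yx zx e)))
      ...   | x , xL , inj₂ (zx , yx) = subst₂ (λ a b → ψ b ≤ suc (ψ a)) (sym yx) (sym zx) (proj₂ (ψ-cycle-lip x xL (trans (B-sym _ _) (subst₂ (λ a b → B a b ≡ true) yx zx e))))

      ψ-lower-bound : ∀ k y → RB k v y ≡ true → ψ y ≤ k
      ψ-lower-bound k y e = subst (λ w → ψ y ≤ w + k) ψv (reach-potential B ψ ψ-lip k e)
        where
        ψv : ψ v ≡ 0
        ψv = trans (ψ-same v refl) (dist-refl F v)

    toB : ∀ k {a b} → RF k a b ≡ true → RB k a b ≡ true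
    toB k e = reach-⊆ F B F⊆B k e

    dist-diff : ∀ v y → ¬ root y ≡ root v → dist B v y ≡ depth v + D (root v) (root y) + depth y
    dist-diff v y ne = ≤-antisym (dist-≤ B _ up) (subst (_≤ dist B v y) (Potential.ψ-diff v y ne) (Potential.ψ-lower-bound v _ y (reach-dist B (depth v + D (root v) (root y) + depth y) up)))
      where
      w1 : RB (depth v) v (pos (root v)) ≡ true
      w1 = toB (depth v) (FRsym (depth v) (reach-dist F n (root-reaches v)))
      w3 : RB (depth y) (pos (root y)) y ≡ true
      w3 = toB (depth y) (reach-dist F n (root-reaches y))
      up : RB (depth v + D (root v) (root y) + depth y) v y ≡ true
      up = reach-++ B (depth v + D (root v) (root y)) (depth y) (reach-++ B (depth v) (D (root v) (root y)) w1 (D-walk (root v) (root y) (root< v) (root< y))) w3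

    dist-same : ∀ v y → root y ≡ root v → dist B v y ≡ dF v y
    dist-same v y eq = ≤-antisym (dist-≤ B _ up) (subst (_≤ dist B v y) (Potential.ψ-same v y eq) (Potential.ψ-lower-bound v _ y (reach-dist B (dF v y) up)))
      where
      up : RB (dF v y) v y ≡ true
      up = toB (dF v y) (reach-dist F (n + n) (same-root-reach v y eq))

    dist-cyc : ∀ p q → p < L → q < L → dist B (pos p) (pos q) ≡ D p q
    dist-cyc p q pL qL with q ≟ℕ p
    ... | yes refl = trans (dist-refl B (pos p)) (sym (D-refl p))
    ... | no ne = trans (dist-diff (pos p) (pos q) (λ e → ne (trans (sym (rq q qL)) (trans e (rq p pL)))))
                    (trans (cong₂ (λ a b → a + D (root (pos p)) (root (pos q)) + b) (depth-cycle p) (depth-cycle q))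
                       (trans (+-identityʳ _) (cong₂ D (rq p pL) (rq q qL))))
      where
      rq : ∀ z → z < L → root (pos z) ≡ z
      rq z zL = trans (root-cycle z) (toℕ-mod z zL)

-- Distances in G and in G minus the edge

module CycleDistances {n : ℕ} (G : Graph n) (g : ℕ) (c : Fin (suc g) → Fin n) (isC : IsCycle G c)
  (uniq : OnlyCycle G c)
  (conn : Connected (adj G)) where
  open CycleSetup G g c
  open WithCycle isC
  open Roots G g c isC uniq conn public

  L3 : 3 ≤ L
  L3 = IsCycle.length≥3 isC

  mod-cong : ∀ x y → x % L ≡ y % L → pos x ≡ pos y
  mod-cong x y e = cong c (toℕ-injective (trans (toℕ-fromℕ< _) (trans e (sym (toℕ-fromℕ< _)))))

  pos-wrap : ∀ z → pos (z + L) ≡ pos z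
  pos-wrap z = mod-cong (z + L) z ([m+n]%n≡m%n z L)

  pos-L : pos L ≡ pos 0
  pos-L = pos-wrap 0

  pos-suc-nrm : ∀ z → pos (suc (nrm z)) ≡ pos (suc z)
  pos-suc-nrm z = mod-cong (suc (nrm z)) (suc z)
    (trans (cong (λ w → suc w % L) (toℕ-fromℕ< _))
    (trans (%-distribˡ-+ 1 (z % L) L) (trans (cong (λ w → (1 % L + w) % L) (m%n%n≡m%n z L)) (sym (%-distribˡ-+ 1 z L)))))

  pos-edge : ∀ z → A (pos z) (pos (suc z)) ≡ true
  pos-edge z = subst₂ (λ a b → A a b ≡ true) (pos-nrm z) (pos-suc-nrm z) (pos-adj (nrm z) (nrm< z))

  nrm-< : ∀ z → z < L → nrm z ≡ z
  nrm-< z zL = toℕ-mod z zL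

  nx-lt : ∀ x → suc x < L → nx x ≡ suc x
  nx-lt x lt = nrm-< (suc x) lt

  nx-L : ∀ x → suc x ≡ L → nx x ≡ 0
  nx-L x e = trans (cong nrm e) (trans (toℕ-fromℕ< _) (n%n≡0 L))

  module ArcWalks (B : Adj n) (ok : ℕ → Set) (edge : ∀ x → x < L → ok x → B (pos x) (pos (suc x)) ≡ true) where
    arc-walk : ∀ a t → a + t ≤ L → (∀ x → a ≤ x → x < a + t → ok x) → reachWithin B t (pos a) (pos (a + t)) ≡ true
    arc-walk a zero le okf = subst (λ z → reachWithin B 0 (pos a) (pos z) ≡ true) (sym (+-identityʳ a)) (reach-refl B (pos a))
    arc-walk a (suc t) le okf = subst (λ z → reachWithin B (suc t) (pos a) (pos z) ≡ true) (sym (+-suc a t))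
        (reach-snoc B t (arc-walk a t (≤-trans (+-monoʳ-≤ a (n≤1+n t)) le) (λ x ax xl → okf x ax (≤-trans xl (+-monoʳ-≤ a (n≤1+n t)))))
           (edge (a + t) (subst (_≤ L) (+-suc a t) le) (okf (a + t) (m≤m+n a t) (≤-reflexive (sym (+-suc a t))))))

    arc-walk-up : ∀ p q → p ≤ q → q < L → (∀ x → p ≤ x → x < q → ok x) → reachWithin B (q ∸ p) (pos p) (pos q) ≡ true
    arc-walk-up p q le qL okf = subst (λ z → reachWithin B (q ∸ p) (pos p) (pos z) ≡ true) (m+[n∸m]≡n le)
       (arc-walk p (q ∸ p) (≤-trans (≤-reflexive (m+[n∸m]≡n le)) (<⇒≤ qL)) (λ x px xl → okf x px (subst (x <_) (m+[n∸m]≡n le) xl)))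

    arc-walk-around : ∀ p q → p ≤ q → q < L → (∀ x → q ≤ x → x < L → ok x) → (∀ x → x < p → ok x) →
            reachWithin B (L ∸ q + p) (pos q) (pos p) ≡ true
    arc-walk-around p q le qL ok1 ok2 = reach-++ B (L ∸ q) p w1 (subst (λ z → reachWithin B p z (pos p) ≡ true) (sym pos-L) w2)
      where
      w1 : reachWithin B (L ∸ q) (pos q) (pos L) ≡ true
      w1 = subst (λ z → reachWithin B (L ∸ q) (pos q) (pos z) ≡ true) (m+[n∸m]≡n (<⇒≤ qL))
             (arc-walk q (L ∸ q) (≤-reflexive (m+[n∸m]≡n (<⇒≤ qL))) (λ x qx xl → ok1 x qx (subst (x <_) (m+[n∸m]≡n (<⇒≤ qL)) xl)))
      w2 : reachWithin B p (pos 0) (pos p) ≡ true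
      w2 = arc-walk 0 p (≤-trans le (<⇒≤ qL)) (λ x _ xl → ok2 x xl)

  L∸[q∸p]≡L∸q+p : ∀ p q → p ≤ q → q ≤ L → L ∸ (q ∸ p) ≡ L ∸ q + p
  L∸[q∸p]≡L∸q+p p q pq qL = begin
      L ∸ (q ∸ p)               ≡⟨ cong (_∸ (q ∸ p)) (sym (m∸n+n≡m qL)) ⟩
      (L ∸ q + q) ∸ (q ∸ p)     ≡⟨ +-∸-assoc (L ∸ q) (m∸n≤m q p) ⟩
      L ∸ q + (q ∸ (q ∸ p))     ≡⟨ cong (L ∸ q +_) (m∸[m∸n]≡n pq) ⟩
      L ∸ q + p ∎
    where open ≡-Reasoning

  cycleDist : ℕ → ℕ → ℕ
  cycleDist p q = ∣ p - q ∣ ⊓ (L ∸ ∣ p - q ∣)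

  cycleDist-refl : ∀ p → cycleDist p p ≡ 0
  cycleDist-refl p rewrite ∣n-n∣≡0 p = refl

  cycleDist-sym : ∀ p q → cycleDist p q ≡ cycleDist q p
  cycleDist-sym p q rewrite ∣-∣-comm p q = refl

  module WA = ArcWalks A (λ _ → ⊤) (λ x _ _ → pos-edge x)

  A-sym = Graph.sym G

  cycleDist-walk-≤ : ∀ p q → p ≤ q → q < L → reachWithin A (cycleDist p q) (pos p) (pos q) ≡ true
  cycleDist-walk-≤ p q le qL with ⊓-sel ∣ p - q ∣ (L ∸ ∣ p - q ∣)
  ... | inj₁ e = subst (λ z → reachWithin A z (pos p) (pos q) ≡ true) (sym (trans e (m≤n⇒∣m-n∣≡n∸m le))) (WA.arc-walk-up p q le qL (λ _ _ _ → tt))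
  ... | inj₂ e = subst (λ z → reachWithin A z (pos p) (pos q) ≡ true) (sym (trans e (trans (cong (L ∸_) (m≤n⇒∣m-n∣≡n∸m le)) (L∸[q∸p]≡L∸q+p p q le (<⇒≤ qL)))))
                   (Sym.reach-sym A A-sym (L ∸ q + p) (WA.arc-walk-around p q le qL (λ _ _ _ → tt) (λ _ _ → tt)))

  cycleDist-walk : ∀ p q → p < L → q < L → reachWithin A (cycleDist p q) (pos p) (pos q) ≡ true
  cycleDist-walk p q pL qL with ≤-total p q
  ... | inj₁ le = cycleDist-walk-≤ p q le qL
  ... | inj₂ le = subst (λ z → reachWithin A z (pos p) (pos q) ≡ true) (cycleDist-sym q p) (Sym.reach-sym A A-sym (cycleDist q p) (cycleDist-walk-≤ q p le pL))

  cycleDist-lip : ∀ x → x < L → A (pos x) (pos (suc x)) ≡ true → ∀ ρ → ρ < L → Lip (cycleDist ρ (nx x)) (cycleDist ρ x)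
  cycleDist-lip x xL _ ρ ρL with suc x <? L
  ... | yes lt rewrite nx-lt x lt = lip-⊓ (lip-abs ρ x) (lip-∸ L (lip-abs ρ x))
  ... | no nlt = subst₂ Lip (sym e0) (sym eg) (lip-wrap ρ (g ∸ ρ))
    where
    xg : x ≡ g
    xg = ≤-antisym (≤-pred xL) (≤-pred (≮⇒≥ nlt))
    ρg : ρ ≤ g
    ρg = ≤-pred ρL
    e0 : cycleDist ρ (nx x) ≡ ρ ⊓ suc (g ∸ ρ)
    e0 = trans (cong (cycleDist ρ) (nx-L x (cong suc xg))) (trans (cong (λ w → w ⊓ (L ∸ w)) (∣-∣-identityʳ ρ)) (cong (ρ ⊓_) (+-∸-assoc 1 ρg)))
    eg : cycleDist ρ x ≡ (g ∸ ρ) ⊓ suc ρ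
    eg = trans (cong (cycleDist ρ) xg) (trans (cong (λ w → w ⊓ (L ∸ w)) (m≤n⇒∣m-n∣≡n∸m ρg))
           (cong ((g ∸ ρ) ⊓_) (trans (+-∸-assoc 1 (m∸n≤m g ρ)) (cong suc (m∸[m∸n]≡n ρg)))))

  module DistG = DistanceFormula A A-sym (λ _ _ e → e) F⊆A cycleDist cycleDist-refl cycleDist-lip cycleDist-walk

  module MinusEdge (k : ℕ) (k1 : 1 ≤ k) (kL : k < L) where
    x0 = pos (k ∸ 1)
    y0 = pos k
    T : Adj n
    T = removeEdge A x0 y0

    sk : suc (k ∸ 1) ≡ k
    sk = m+[n∸m]≡n k1

    k1L : k ∸ 1 < L
    k1L = ≤-trans (s≤s (m∸n≤m k 1)) kL

    T-sym : ∀ a b → T a b ≡ T b a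
    T-sym a b rewrite A-sym a b = cong (λ z → A b a ∧ not z)
      (trans (∨-comm ((a == x0) ∧ (b == y0)) _) (cong₂ _∨_ (∧-comm (a == y0) _) (∧-comm (a == x0) _)))

    T⊆A : ∀ a b → T a b ≡ true → A a b ≡ true
    T⊆A a b e = ∧-conicalˡ _ _ e

    cE-e : cE x0 y0 ≡ true
    cE-e = subst (λ z → cE x0 (pos z) ≡ true) sk (pos-cE (k ∸ 1) k1L)

    F⊆T : ∀ a b → F a b ≡ true → T a b ≡ true
    F⊆T a b e = ∧-true (F⊆A a b e) (false⇒not-true _ inner)
      where
      inner : (((a == x0) ∧ (b == y0)) ∨ ((a == y0) ∧ (b == x0))) ≡ false
      inner = ¬true⇒false _ λ q → hh (∨-true⁻ _ _ q)
        where
        hh : ((a == x0) ∧ (b == y0)) ≡ true ⊎ ((a == y0) ∧ (b == x0)) ≡ true → ⊥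
        hh (inj₁ q) = true≢false (subst₂ (λ u v → cE u v ≡ true) (sym ax) (sym by) cE-e) (F-notcE a b e)
          where
          ax : a ≡ x0
          ax = ==⇒≡ {a = a} {b = x0} (∧-conicalˡ (a == x0) (b == y0) q)
          by : b ≡ y0
          by = ==⇒≡ {a = b} {b = y0} (∧-conicalʳ (a == x0) (b == y0) q)
        hh (inj₂ q) = true≢false (trans (cE-sym a b) (subst₂ (λ u v → cE u v ≡ true) (sym bx) (sym ay) cE-e)) (F-notcE a b e)
          where
          ay : a ≡ y0
          ay = ==⇒≡ {a = a} {b = y0} (∧-conicalˡ (a == y0) (b == x0) q)
          bx : b ≡ x0
          bx = ==⇒≡ {a = b} {b = x0} (∧-conicalʳ (a == y0) (b == x0) q)

    T-edge : ∀ x → x < L → ¬ x ≡ k ∸ 1 → T (pos x) (pos (suc x)) ≡ true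
    T-edge x xL ne = ∧-true (pos-edge x) (false⇒not-true _ inner)
      where
      d1 : (pos x == x0) ≡ false
      d1 = ≢⇒==-false (λ q → ne (pos-inj x (k ∸ 1) xL k1L q))
      d2 : ((pos x == y0) ∧ (pos (suc x) == x0)) ≡ false
      d2 with x ≟ℕ k
      ... | no xk = cong (_∧ (pos (suc x) == x0)) (≢⇒==-false (λ q → xk (pos-inj x k xL kL q)))
      ... | yes refl = trans (cong ((pos k == y0) ∧_) (≢⇒==-false lemma)) (∧-zeroʳ _)
        where
        lemma : ¬ pos (suc k) ≡ pos (k ∸ 1)
        lemma q with suc k <? L
        ... | yes lt = <-irrefl (pos-inj (k ∸ 1) (suc k) k1L lt (sym q)) (s≤s (m∸n≤m k 1))
        ... | no nlt = <⇒≱ L3 (subst (_≤ 2) (sym Lk) (s≤s (m∸n≡0⇒m≤n k0)))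
          where
          Lk : L ≡ suc k
          Lk = ≤-antisym (≮⇒≥ nlt) kL
          k0 : k ∸ 1 ≡ 0
          k0 = sym (pos-inj 0 (k ∸ 1) (≤-trans (s≤s z≤n) kL) k1L (trans (sym pos-L) (trans (cong pos Lk) q)))
      inner : (((pos x == x0) ∧ (pos (suc x) == y0)) ∨ ((pos x == y0) ∧ (pos (suc x) == x0))) ≡ false
      inner rewrite d1 = d2

    -- Removing the edge between positions k ∸ 1 and k leaves the path k, k + 1, …, L ∸ 1, 0, …, k ∸ 1;
    -- σ p is the place of position p along it.
    σ' : (p : ℕ) → Dec (p < k) → ℕ
    σ' p (yes _) = p + (L ∸ k)
    σ' p (no _) = p ∸ k

    σ : ℕ → ℕ
    σ p = σ' p (p <? k)

    σ-lo : ∀ p → p < k → σ p ≡ p + (L ∸ k)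
    σ-lo p lt with p <? k
    ... | yes _ = refl
    ... | no nlt = ⊥-elim (nlt lt)

    σ-hi : ∀ p → k ≤ p → σ p ≡ p ∸ k
    σ-hi p le with p <? k
    ... | yes lt = ⊥-elim (<⇒≱ lt le)
    ... | no _ = refl

    σ-step : ∀ x → x < L → ¬ x ≡ k ∸ 1 → σ (nx x) ≡ suc (σ x)
    σ-step x xL ne with suc x <? L
    ... | yes sL = trans (cong σ (nx-lt x sL)) (hs (x <? k))
      where
      hs : Dec (x < k) → σ (suc x) ≡ suc (σ x)
      hs (yes lt) = trans (σ-lo (suc x) (≤∧≢⇒< lt (λ q → ne (trans (sym (m+n∸m≡n 1 x)) (cong (_∸ 1) q))))) (cong suc (sym (σ-lo x lt)))
      hs (no nlt) = trans (σ-hi (suc x) (≤-trans (≮⇒≥ nlt) (n≤1+n x))) (trans (+-∸-assoc 1 (≮⇒≥ nlt)) (cong suc (sym (σ-hi x (≮⇒≥ nlt)))))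
    ... | no nsL = trans (cong σ (nx-L x (≤-antisym xL (≮⇒≥ nsL)))) (trans (σ-lo 0 k1) (trans (+-∸-assoc 1 kg) (cong suc (sym (trans (cong σ xg) (σ-hi g kg))))))
      where
      xg : x ≡ g
      xg = ≤-antisym (≤-pred xL) (≤-pred (≮⇒≥ nsL))
      kg : k ≤ g
      kg = ≤-pred kL

    pathDist : ℕ → ℕ → ℕ
    pathDist p q = ∣ σ p - σ q ∣

    pathDist-refl : ∀ p → pathDist p p ≡ 0
    pathDist-refl p = ∣n-n∣≡0 (σ p)

    pathDist-sym : ∀ p q → pathDist p q ≡ pathDist q p
    pathDist-sym p q = ∣-∣-comm (σ p) (σ q)

    T-e : T x0 y0 ≡ false
    T-e rewrite ==-refl x0 | ==-refl y0 = ∧-zeroʳ _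

    pathDist-lip : ∀ x → x < L → T (pos x) (pos (suc x)) ≡ true → ∀ ρ → ρ < L → Lip (pathDist ρ (nx x)) (pathDist ρ x)
    pathDist-lip x xL e ρ ρL = subst (λ z → Lip ∣ σ ρ - z ∣ (pathDist ρ x)) (sym (σ-step x xL ne)) (lip-abs (σ ρ) (σ x))
      where
      ne : ¬ x ≡ k ∸ 1
      ne q = true≢false (subst₂ (λ a b → T a b ≡ true) (cong pos q) (cong pos (trans (cong suc q) sk)) e) T-e

    pathDist-lo : ∀ p q → p < k → q < k → pathDist p q ≡ ∣ p - q ∣
    pathDist-lo p q pk qk = trans (cong₂ ∣_-_∣ (trans (σ-lo p pk) (+-comm p _)) (trans (σ-lo q qk) (+-comm q _)))
                                  (∣m+n-m+o∣≡∣n-o∣ (L ∸ k) p q)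

    pathDist-hi : ∀ p q → k ≤ p → k ≤ q → pathDist p q ≡ ∣ p - q ∣
    pathDist-hi p q kp kq = trans (cong₂ ∣_-_∣ (σ-hi p kp) (σ-hi q kq)) (∣m∸o-n∸o∣≡∣m-n∣ k p q kp kq)

    pathDist-across : ∀ p q → p < k → k ≤ q → q < L → pathDist p q ≡ L ∸ q + p
    pathDist-across p q pk kq qL = begin
        ∣ σ p - σ q ∣             ≡⟨ cong₂ ∣_-_∣ (σ-lo p pk) (σ-hi q kq) ⟩
        ∣ p + (L ∸ k) - (q ∸ k) ∣ ≡⟨ ∣-∣-comm (p + (L ∸ k)) (q ∸ k) ⟩
        ∣ q ∸ k - p + (L ∸ k) ∣   ≡⟨ m≤n⇒∣m-n∣≡n∸m (≤-trans (∸-monoˡ-≤ k (<⇒≤ qL)) (m≤n+m (L ∸ k) p)) ⟩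
        p + (L ∸ k) ∸ (q ∸ k)     ≡⟨ +-∸-assoc p (∸-monoˡ-≤ k (<⇒≤ qL)) ⟩
        p + ((L ∸ k) ∸ (q ∸ k))   ≡⟨ cong (p +_) ([o∸m]∸[n∸m]≡o∸n k q L kq (<⇒≤ qL)) ⟩
        p + (L ∸ q)               ≡⟨ +-comm p (L ∸ q) ⟩
        L ∸ q + p                 ∎
      where open ≡-Reasoning

    ok-lo : ∀ x p → x < p → p < k → ¬ x ≡ k ∸ 1
    ok-lo x p xp pk e = <-irrefl e (≤-trans xp (≤-trans (≤-reflexive (sym (m+n∸m≡n 1 p))) (∸-monoˡ-≤ 1 pk)))

    ok-hi : ∀ x → k ≤ x → ¬ x ≡ k ∸ 1
    ok-hi x kx e = <-irrefl (sym e) (≤-trans (≤-reflexive sk) kx)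

    module WT = ArcWalks T (λ x → ¬ x ≡ k ∸ 1) (λ x xL ne → T-edge x xL ne)

    RT = reachWithin T

    pathDist-walk-≤ : ∀ p q → p ≤ q → q < L → RT (pathDist p q) (pos p) (pos q) ≡ true
    pathDist-walk-≤ p q le qL = cases (q <? k) (p <? k)
      where
      cases : Dec (q < k) → Dec (p < k) → RT (pathDist p q) (pos p) (pos q) ≡ true
      cases (yes qk) _ = subst (λ z → RT z (pos p) (pos q) ≡ true)
        (sym (trans (pathDist-lo p q (≤-<-trans le qk) qk) (m≤n⇒∣m-n∣≡n∸m le)))
        (WT.arc-walk-up p q le qL (λ x _ xq → ok-lo x q xq qk))
      cases (no qk) (no pk) = subst (λ z → RT z (pos p) (pos q) ≡ true)
        (sym (trans (pathDist-hi p q (≮⇒≥ pk) (≮⇒≥ qk)) (m≤n⇒∣m-n∣≡n∸m le)))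
        (WT.arc-walk-up p q le qL (λ x px _ → ok-hi x (≤-trans (≮⇒≥ pk) px)))
      cases (no qk) (yes pk) = subst (λ z → RT z (pos p) (pos q) ≡ true) (sym (pathDist-across p q pk (≮⇒≥ qk) qL))
        (Sym.reach-sym T T-sym (L ∸ q + p)
          (WT.arc-walk-around p q le qL (λ x qx _ → ok-hi x (≤-trans (≮⇒≥ qk) qx)) (λ x xp → ok-lo x p xp pk)))

    pathDist-walk : ∀ p q → p < L → q < L → RT (pathDist p q) (pos p) (pos q) ≡ true
    pathDist-walk p q pL qL with ≤-total p q
    ... | inj₁ le = pathDist-walk-≤ p q le qL
    ... | inj₂ le = subst (λ z → RT z (pos p) (pos q) ≡ true) (pathDist-sym q p) (Sym.reach-sym T T-sym (pathDist q p) (pathDist-walk-≤ q p le pL))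

    module DistT = DistanceFormula T T-sym T⊆A F⊆T pathDist pathDist-refl pathDist-lip pathDist-walk

-- Finite sums

Σ : ℕ → (ℕ → ℕ) → ℕ
Σ zero f = 0
Σ (suc m) f = f 0 + Σ m (λ t → f (suc t))

Σ-cong : ∀ m {f g} → (∀ t → t < m → f t ≡ g t) → Σ m f ≡ Σ m g
Σ-cong zero h = refl
Σ-cong (suc m) h = cong₂ _+_ (h 0 (s≤s z≤n)) (Σ-cong m (λ t lt → h (suc t) (s≤s lt)))

Σ-zero : ∀ m {f} → (∀ t → t < m → f t ≡ 0) → Σ m f ≡ 0
Σ-zero zero h = refl
Σ-zero (suc m) h rewrite h 0 (s≤s z≤n) = Σ-zero m (λ t lt → h (suc t) (s≤s lt))

Σ-+ : ∀ m (f g : ℕ → ℕ) → Σ m (λ t → f t + g t) ≡ Σ m f + Σ m g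
Σ-+ zero f g = refl
Σ-+ (suc m) f g rewrite Σ-+ m (λ t → f (suc t)) (λ t → g (suc t)) = +-exch {f 0} {g 0} {Σ m (λ t → f (suc t))} {Σ m (λ t → g (suc t))}
  where
  +-exch : ∀ {a b x y} → a + b + (x + y) ≡ a + x + (b + y)
  +-exch {a} {b} {x} {y} = begin
     a + b + (x + y) ≡⟨ +-assoc a b (x + y) ⟩
     a + (b + (x + y)) ≡⟨ cong (a +_) (sym (+-assoc b x y)) ⟩
     a + (b + x + y) ≡⟨ cong (λ z → a + (z + y)) (+-comm b x) ⟩
     a + (x + b + y) ≡⟨ cong (a +_) (+-assoc x b y) ⟩
     a + (x + (b + y)) ≡⟨ sym (+-assoc a x (b + y)) ⟩
     a + x + (b + y) ∎
    where open ≡-Reasoning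

Σ-* : ∀ m a (f : ℕ → ℕ) → Σ m (λ t → a * f t) ≡ a * Σ m f
Σ-* zero a f = sym (*-zeroʳ a)
Σ-* (suc m) a f rewrite Σ-* m a (λ t → f (suc t)) = sym (*-distribˡ-+ a (f 0) _)

Σ-split : ∀ a b (f : ℕ → ℕ) → Σ (a + b) f ≡ Σ a f + Σ b (λ t → f (a + t))
Σ-split zero b f = refl
Σ-split (suc a) b f rewrite Σ-split a b (λ t → f (suc t)) = sym (+-assoc (f 0) _ _)

Σ-last : ∀ m (f : ℕ → ℕ) → Σ (suc m) f ≡ Σ m f + f m
Σ-last m f = trans (cong (λ z → Σ z f) (+-comm 1 m)) (trans (Σ-split m 1 f) (cong (Σ m f +_) (trans (+-identityʳ (f (m + 0))) (cong f (+-identityʳ m)))))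

Σ-rev : ∀ m (f : ℕ → ℕ) → Σ m f ≡ Σ m (λ t → f (m ∸ suc t))
Σ-rev zero f = refl
Σ-rev (suc m) f = begin
  Σ (suc m) f ≡⟨ Σ-last m f ⟩
  Σ m f + f m ≡⟨ cong (_+ f m) (Σ-rev m f) ⟩
  Σ m (λ t → f (m ∸ suc t)) + f m ≡⟨ +-comm _ (f m) ⟩
  f m + Σ m (λ t → f (m ∸ suc t)) ≡⟨ cong (f m +_) refl ⟩
  f (suc m ∸ 1) + Σ m (λ t → f (suc m ∸ suc (suc t))) ∎
  where open ≡-Reasoning

Σ-swap : ∀ m k (f : ℕ → ℕ → ℕ) → Σ m (λ i → Σ k (λ j → f i j)) ≡ Σ k (λ j → Σ m (λ i → f i j))
Σ-swap zero k f = sym (Σ-zero k (λ _ _ → refl))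
Σ-swap (suc m) k f = begin
  Σ k (λ j → f 0 j) + Σ m (λ i → Σ k (λ j → f (suc i) j)) ≡⟨ cong (Σ k (λ j → f 0 j) +_) (Σ-swap m k (λ i j → f (suc i) j)) ⟩
  Σ k (λ j → f 0 j) + Σ k (λ j → Σ m (λ i → f (suc i) j)) ≡⟨ sym (Σ-+ k _ _) ⟩
  Σ k (λ j → f 0 j + Σ m (λ i → f (suc i) j)) ∎
  where open ≡-Reasoning

sum-applyUpTo : ∀ m (g : ℕ → ℕ) (h : ℕ → ℕ) → sum (map g (applyUpTo h m)) ≡ Σ m (λ t → g (h t))
sum-applyUpTo zero g h = refl
sum-applyUpTo (suc m) g h = cong (g (h 0) +_) (sum-applyUpTo m g (λ t → h (suc t)))

sum-upTo : ∀ m (g : ℕ → ℕ) → sum (map g (upTo m)) ≡ Σ m g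
sum-upTo m g = sum-applyUpTo m g (λ t → t)

ΣL : ∀ {A : Set} → List A → (A → ℕ) → ℕ
ΣL xs f = sum (map f xs)

ΣL-+ : ∀ {A : Set} (xs : List A) (f g : A → ℕ) → ΣL xs (λ x → f x + g x) ≡ ΣL xs f + ΣL xs g
ΣL-+ [] f g = refl
ΣL-+ (x ∷ xs) f g rewrite ΣL-+ xs f g = ex {f x} {g x} {ΣL xs f} {ΣL xs g}
  where
  ex : ∀ {a b c d} → a + b + (c + d) ≡ a + c + (b + d)
  ex {a} {b} {c} {d} = trans (+-assoc a b (c + d)) (trans (cong (a +_) (trans (sym (+-assoc b c d)) (trans (cong (_+ d) (+-comm b c)) (+-assoc c b d)))) (sym (+-assoc a c (b + d))))

ΣL-* : ∀ {A : Set} (xs : List A) a (f : A → ℕ) → ΣL xs (λ x → a * f x) ≡ a * ΣL xs f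
ΣL-* [] a f = sym (*-zeroʳ a)
ΣL-* (x ∷ xs) a f rewrite ΣL-* xs a f = sym (*-distribˡ-+ a (f x) _)

ΣL-cong : ∀ {A : Set} (xs : List A) {f g} → (∀ x → f x ≡ g x) → ΣL xs f ≡ ΣL xs g
ΣL-cong [] h = refl
ΣL-cong (x ∷ xs) h = cong₂ _+_ (h x) (ΣL-cong xs h)

ΣL-Σ : ∀ {A : Set} (xs : List A) m (f : A → ℕ → ℕ) → ΣL xs (λ x → Σ m (f x)) ≡ Σ m (λ t → ΣL xs (λ x → f x t))
ΣL-Σ [] m f = sym (Σ-zero m (λ _ _ → refl))
ΣL-Σ (x ∷ xs) m f rewrite ΣL-Σ xs m f = sym (Σ-+ m (f x) _)

ΣL-swap : ∀ {A B : Set} (xs : List A) (ys : List B) (f : A → B → ℕ) → ΣL xs (λ x → ΣL ys (λ y → f x y)) ≡ ΣL ys (λ y → ΣL xs (λ x → f x y))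
ΣL-swap [] ys f = sym (ΣL-zero ys)
  where
  ΣL-zero : ∀ {B : Set} (ys : List B) → ΣL ys (λ _ → 0) ≡ 0
  ΣL-zero [] = refl
  ΣL-zero (y ∷ ys) = ΣL-zero ys
ΣL-swap (x ∷ xs) ys f rewrite ΣL-swap xs ys f = sym (ΣL-+ ys (f x) _)

2*m≡m+m : ∀ m → 2 * m ≡ m + m
2*m≡m+m m = cong (m +_) (+-identityʳ m)

≤⇒∃+ : ∀ {m n} → m ≤ n → ∃ (λ o → m + o ≡ n)
≤⇒∃+ {m} {n} le = n ∸ m , m+[n∸m]≡n le

m≡n+o⇒m∸n≡o : ∀ {z} x y → z ≡ x + y → z ∸ x ≡ y
m≡n+o⇒m∸n≡o {z} x y e = trans (cong (_∸ x) e) (m+n∸m≡n x y)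

2k∸[k+b]≡k∸b : ∀ k b → 2 * k ∸ (k + b) ≡ k ∸ b
2k∸[k+b]≡k∸b k b = trans (cong (_∸ (k + b)) (2*m≡m+m k)) ([m+n]∸[m+o]≡n∸o k k b)

excess-even : ∀ k a b → a < k → b < k → (2 * k ∸ (k + b) + a) ∸ (k + b ∸ a) ≡ 2 * (a ∸ b)
excess-even k a b ak bk rewrite 2k∸[k+b]≡k∸b k b with b ≤? a
... | yes ba with ≤⇒∃+ ba
...   | d , refl with ≤⇒∃+ ak
...     | r , refl = trans (cong₂ _∸_ f1 f2) (trans (m≡n+o⇒m∸n≡o (suc (r + b)) (d + d) (l3 b d r)) (sym (trans (cong (2 *_) (m≡n+o⇒m∸n≡o b d refl)) (2*m≡m+m d))))
  where
  l1 : ∀ b d r → suc (b + d) + r ≡ b + suc (d + r)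
  l1 = solve-∀
  f1 : suc (b + d) + r ∸ b + (b + d) ≡ suc (d + r) + (b + d)
  f1 = cong (_+ (b + d)) (m≡n+o⇒m∸n≡o b (suc (d + r)) (l1 b d r))
  l2 : ∀ b d r → suc (b + d) + r + b ≡ (b + d) + suc (r + b)
  l2 = solve-∀
  f2 : suc (b + d) + r + b ∸ (b + d) ≡ suc (r + b)
  f2 = m≡n+o⇒m∸n≡o (b + d) (suc (r + b)) (l2 b d r)
  l3 : ∀ b d r → suc (d + r) + (b + d) ≡ suc (r + b) + (d + d)
  l3 = solve-∀
excess-even k a b ak bk | no nba = trans (m≤n⇒m∸n≡0 le) (sym (cong (2 *_) (m≤n⇒m∸n≡0 (<⇒≤ a<b))))
  where
  a<b : a < b
  a<b = ≰⇒> nba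
  le : k ∸ b + a ≤ k + b ∸ a
  le = ≤-trans (+-monoʳ-≤ (k ∸ b) (<⇒≤ a<b)) (≤-trans (≤-reflexive (m∸n+n≡m (<⇒≤ bk))) (≤-trans (m≤m+n k (b ∸ a)) (≤-reflexive (sym (+-∸-assoc k (<⇒≤ a<b))))))

2k∸1∸[k+b]≡k∸suc[b] : ∀ k b → 2 * k ∸ 1 ∸ (k + b) ≡ k ∸ suc b
2k∸1∸[k+b]≡k∸suc[b] k b = trans (∸-+-assoc (2 * k) 1 (k + b)) (trans (cong (2 * k ∸_) (sym (+-suc k b))) (2k∸[k+b]≡k∸b k (suc b)))
  where _⟨trans⟩_ = trans

excess-odd : ∀ k a b → a < k → suc b < k → (2 * k ∸ 1 ∸ (k + b) + a) ∸ (k + b ∸ a) ≡ 2 * (a ∸ b) ∸ 1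
excess-odd k a b ak bk rewrite 2k∸1∸[k+b]≡k∸suc[b] k b with b ≤? a
... | yes ba with ≤⇒∃+ ba
...   | d , refl with ≤⇒∃+ ak
...     | r , refl = trans (cong₂ _∸_ f1 f2) (trans fin (sym (cong (_∸ 1) (trans (cong (2 *_) (m≡n+o⇒m∸n≡o b d refl)) (2*m≡m+m d)))))
  where
  l1 : ∀ b d r → suc (b + d) + r ≡ suc b + (d + r)
  l1 = solve-∀
  f1 : suc (b + d) + r ∸ suc b + (b + d) ≡ (d + r) + (b + d)
  f1 = cong (_+ (b + d)) (m≡n+o⇒m∸n≡o (suc b) (d + r) (l1 b d r))
  l2 : ∀ b d r → suc (b + d) + r + b ≡ (b + d) + suc (r + b)
  l2 = solve-∀
  f2 : suc (b + d) + r + b ∸ (b + d) ≡ suc (r + b)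
  f2 = m≡n+o⇒m∸n≡o (b + d) (suc (r + b)) (l2 b d r)
  l3 : ∀ b d r → (d + r) + (b + d) ≡ (r + b) + (d + d)
  l3 = solve-∀
  fin : (d + r) + (b + d) ∸ suc (r + b) ≡ (d + d) ∸ 1
  fin = trans (cong₂ _∸_ (l3 b d r) (+-comm 1 (r + b))) ([m+n]∸[m+o]≡n∸o (r + b) (d + d) 1)
excess-odd k a b ak bk | no nba = trans (m≤n⇒m∸n≡0 le) (sym (cong (λ z → 2 * z ∸ 1) (m≤n⇒m∸n≡0 (<⇒≤ a<b))))
  where
  a<b : a < b
  a<b = ≰⇒> nba
  le : k ∸ suc b + a ≤ k + b ∸ a
  le = ≤-trans (+-monoʳ-≤ (k ∸ suc b) (≤-trans (<⇒≤ a<b) (n≤1+n b))) (≤-trans (≤-reflexive (m∸n+n≡m (<⇒≤ bk))) (≤-trans (m≤m+n k (b ∸ a)) (≤-reflexive (sym (+-∸-assoc k (<⇒≤ a<b))))))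

even-lower : ∀ k t → k + 2 ∸ (2 + t) ≡ k ∸ t
even-lower k t = cong (_∸ (2 + t)) (+-comm k 2)

even-weight : ∀ k t t' → t ≤ k → (2 + t) + ((k ∸ t) + t') ∸ (k + 1) ≡ suc t'
even-weight k t t' le with ≤⇒∃+ le
... | v , refl = trans (cong (λ z → (2 + t) + (z + t') ∸ (t + v + 1)) (m+n∸m≡n t v)) (m≡n+o⇒m∸n≡o (t + v + 1) (suc t') (l t v t'))
  where
  l : ∀ t v t' → (2 + t) + (v + t') ≡ t + v + 1 + suc t'
  l = solve-∀

even-partner : ∀ k t t' → t' ≤ t → t ≤ k → 2 * k ∸ ((k ∸ t) + t') ≡ k + (t ∸ t')
even-partner k t t' le1 le2 with ≤⇒∃+ le1
... | u , refl with ≤⇒∃+ le2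
...   | v , refl = trans (cong (λ z → 2 * (t' + u + v) ∸ (z + t')) (m+n∸m≡n (t' + u) v))
                    (trans (m≡n+o⇒m∸n≡o (v + t') (t' + u + v + u) (l t' u v)) (cong (t' + u + v +_) (sym (m+n∸m≡n t' u))))
  where
  l : ∀ t' u v → 2 * (t' + u + v) ≡ v + t' + (t' + u + v + u)
  l = solve-∀

odd-lower : ∀ k t → k + 1 ∸ (2 + t) ≡ k ∸ suc t
odd-lower k t = cong (_∸ (2 + t)) (+-comm k 1)

odd-count : ∀ k t → suc t ≤ k → suc (k ∸ 1) ∸ (k ∸ suc t) ≡ suc t
odd-count k t le = trans (cong (_∸ (k ∸ suc t)) (m+[n∸m]≡n (≤-trans (s≤s z≤n) le))) (m∸[m∸n]≡n le)

odd-weight : ∀ k t t' → suc t ≤ k → (2 + t) + ((k ∸ suc t) + t') ∸ k ≡ suc t'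
odd-weight k t t' le with ≤⇒∃+ le
... | v , refl = trans (cong (λ z → (2 + t) + (z + t') ∸ (suc t + v)) (m+n∸m≡n (suc t) v)) (m≡n+o⇒m∸n≡o (suc t + v) (suc t') (l t v t'))
  where
  l : ∀ t v t' → (2 + t) + (v + t') ≡ suc t + v + suc t'
  l = solve-∀

odd-partner : ∀ k t t' → t' ≤ t → suc t ≤ k → 2 * k ∸ 1 ∸ ((k ∸ suc t) + t') ≡ k + (t ∸ t')
odd-partner k t t' le1 le2 with ≤⇒∃+ le1
... | u , refl with ≤⇒∃+ le2
...   | v , refl = trans (∸-+-assoc (2 * (suc (t' + u) + v)) 1 ((suc (t' + u) + v ∸ suc (t' + u)) + t'))
                    (trans (cong (λ z → 2 * (suc (t' + u) + v) ∸ (1 + (z + t'))) (m+n∸m≡n (suc (t' + u)) v))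
                    (trans (m≡n+o⇒m∸n≡o (1 + (v + t')) (suc (t' + u) + v + u) (l t' u v)) (cong (suc (t' + u) + v +_) (sym (m+n∸m≡n t' u)))))
  where
  l : ∀ t' u v → 2 * (suc (t' + u) + v) ≡ 1 + (v + t') + (suc (t' + u) + v + u)
  l = solve-∀

suc[m]∸[m∸n]≡suc[n] : ∀ m n → n ≤ m → suc m ∸ (m ∸ n) ≡ suc n
suc[m]∸[m∸n]≡suc[n] m n le = trans (+-∸-assoc 1 (m∸n≤m m n)) (cong suc (m∸[m∸n]≡n le))

-- The cross pairs (a, k + b) with a = t + 1 and b = t ∸ t′, so that a ∸ b = t′ + 1.
reindexedSum : ℕ → (ℕ → ℕ) → (ℕ → ℕ) → ℕ
reindexedSum k s C = Σ (k ∸ 1) (λ t → Σ (suc t) (λ t' → s (suc t) * s (k + (t ∸ t')) * C (suc t')))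

-- An excess vanishing on pairs from the same side of k makes the sum over all ordered pairs twice
-- the sum X over the pairs (a, k + b) across it.
module PairSums (L k : ℕ) (s : ℕ → ℕ) (excess : ℕ → ℕ → ℕ) (kL : k ≤ L)
  (excess-sym : ∀ p q → excess p q ≡ excess q p)
  (excess-lo : ∀ p q → p < k → q < k → excess p q ≡ 0)
  (excess-hi : ∀ p q → k ≤ p → k ≤ q → p < L → q < L → excess p q ≡ 0) where

  L' = L ∸ k

  M : ℕ → ℕ → ℕ
  M p q = s p * s q * excess p q

  X : ℕ
  X = Σ k (λ a → Σ L' (λ b → M a (k + b)))

  splitL : ∀ f → Σ L f ≡ Σ k f + Σ L' (λ b → f (k + b))
  splitL f = trans (cong (λ z → Σ z f) (sym (m+[n∸m]≡n kL))) (Σ-split k L' f)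

  M0 : ∀ p q → excess p q ≡ 0 → M p q ≡ 0
  M0 p q e rewrite e = *-zeroʳ (s p * s q)

  k+b<L : ∀ b → b < L' → k + b < L
  k+b<L b lt = subst (k + b <_) (m+[n∸m]≡n kL) (+-monoʳ-< k lt)

  inner-lo : ∀ q → q < k → Σ L (λ p → M p q) ≡ Σ L' (λ b → M (k + b) q)
  inner-lo q qk = trans (splitL (λ p → M p q)) (cong (_+ Σ L' (λ b → M (k + b) q)) (Σ-zero k (λ p pk → M0 p q (excess-lo p q pk qk))))

  inner-hi : ∀ b → b < L' → Σ L (λ p → M p (k + b)) ≡ Σ k (λ a → M a (k + b))
  inner-hi b bL = trans (splitL (λ p → M p (k + b)))
     (trans (cong (Σ k (λ a → M a (k + b)) +_) (Σ-zero L' (λ b' bL' → M0 (k + b') (k + b) (excess-hi _ _ (m≤m+n k b') (m≤m+n k b) (k+b<L b' bL') (k+b<L b bL)))))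
       (+-identityʳ _))

  M-sym : ∀ p q → M p q ≡ M q p
  M-sym p q rewrite excess-sym p q = cong (_* excess q p) (*-comm (s p) (s q))

  symmetric-sum≡2X : Σ L (λ q → s q * Σ L (λ p → s p * excess p q)) ≡ 2 * X
  symmetric-sum≡2X = begin
    Σ L (λ q → s q * Σ L (λ p → s p * excess p q))
      ≡⟨ Σ-cong L (λ q _ → trans (sym (Σ-* L (s q) (λ p → s p * excess p q))) (Σ-cong L (λ p _ → re (s q) (s p) (excess p q)))) ⟩
    Σ L (λ q → Σ L (λ p → M p q))
      ≡⟨ splitL (λ q → Σ L (λ p → M p q)) ⟩
    Σ k (λ q → Σ L (λ p → M p q)) + Σ L' (λ b → Σ L (λ p → M p (k + b)))
      ≡⟨ cong₂ _+_ (Σ-cong k (λ q qk → trans (inner-lo q qk) (Σ-cong L' (λ b _ → M-sym (k + b) q))))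
                   (Σ-cong L' (λ b bL → inner-hi b bL)) ⟩
    X + Σ L' (λ b → Σ k (λ a → M a (k + b)))
      ≡⟨ cong (X +_) (sym (Σ-swap k L' (λ a b → M a (k + b)))) ⟩
    X + X
      ≡⟨ sym (2*m≡m+m X) ⟩
    2 * X ∎
    where
    open ≡-Reasoning
    re : ∀ a b c → a * (b * c) ≡ b * a * c
    re = solve-∀

  module CrossSum (C : ℕ → ℕ) (C0 : C 0 ≡ 0) (k1 : 1 ≤ k) (kL' : k ∸ 1 ≤ L')
     (excess-cross-value : ∀ a b → a < k → b < L' → excess a (k + b) ≡ C (a ∸ b)) where

    Y : ℕ
    Y = reindexedSum k s C

    H : ℕ → ℕ
    H a = Σ L' (λ b → M a (k + b))

    H0 : H 0 ≡ 0
    H0 = Σ-zero L' (λ b bL → M0 0 (k + b) (trans (excess-cross-value 0 b k1 bL) (trans (cong C (0∸n≡0 b)) C0)))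

    Hs : ∀ t → t < k ∸ 1 → H (suc t) ≡ Σ (suc t) (λ t' → s (suc t) * s (k + (t ∸ t')) * C (suc t'))
    Hs t lt = begin
      H (suc t)
        ≡⟨ cong (λ z → Σ z (λ b → M (suc t) (k + b))) (sym (m+[n∸m]≡n st≤)) ⟩
      Σ (suc t + (L' ∸ suc t)) (λ b → M (suc t) (k + b))
        ≡⟨ Σ-split (suc t) (L' ∸ suc t) (λ b → M (suc t) (k + b)) ⟩
      Σ (suc t) (λ b → M (suc t) (k + b)) + Σ (L' ∸ suc t) (λ b → M (suc t) (k + (suc t + b)))
        ≡⟨ cong (Σ (suc t) (λ b → M (suc t) (k + b)) +_) (Σ-zero (L' ∸ suc t) (λ b bl → M0 (suc t) _ (zeroC b bl))) ⟩
      Σ (suc t) (λ b → M (suc t) (k + b)) + 0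
        ≡⟨ +-identityʳ _ ⟩
      Σ (suc t) (λ b → M (suc t) (k + b))
        ≡⟨ Σ-rev (suc t) (λ b → M (suc t) (k + b)) ⟩
      Σ (suc t) (λ t' → M (suc t) (k + (t ∸ t')))
        ≡⟨ Σ-cong (suc t) (λ t' lt' → cong (s (suc t) * s (k + (t ∸ t')) *_)
              (trans (excess-cross-value (suc t) (t ∸ t') sk (≤-trans (s≤s (m∸n≤m t t')) st≤)) (cong C (suc[m]∸[m∸n]≡suc[n] t t' (≤-pred lt'))))) ⟩
      Σ (suc t) (λ t' → s (suc t) * s (k + (t ∸ t')) * C (suc t')) ∎
      where
      open ≡-Reasoning
      sk : suc t < k
      sk = subst (suc t <_) (m+[n∸m]≡n k1) (s≤s lt)
      st≤ : suc t ≤ L'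
      st≤ = ≤-trans lt kL'
      zeroC : ∀ b → b < L' ∸ suc t → excess (suc t) (k + (suc t + b)) ≡ 0
      zeroC b bl = trans (excess-cross-value (suc t) (suc t + b) sk (subst (suc t + b <_) (m+[n∸m]≡n st≤) (+-monoʳ-< (suc t) bl)))
                     (trans (cong C (m≤n⇒m∸n≡0 (m≤m+n (suc t) b))) C0)

    X≡Y : X ≡ Y
    X≡Y = begin
      Σ k H ≡⟨ cong (λ z → Σ z H) (sym (m+[n∸m]≡n k1)) ⟩
      H 0 + Σ (k ∸ 1) (λ t → H (suc t)) ≡⟨ cong (_+ Σ (k ∸ 1) (λ t → H (suc t))) H0 ⟩
      Σ (k ∸ 1) (λ t → H (suc t)) ≡⟨ Σ-cong (k ∸ 1) Hs ⟩
      Y ∎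
      where open ≡-Reasoning

sumFromTo≡Σ : ∀ a b f → sumFromTo a b f ≡ Σ (suc b ∸ a) (λ t → f (a + t))
sumFromTo≡Σ a b f = sum-upTo (suc b ∸ a) (λ t → f (a + t))

module EvenFormula (k : ℕ) (s : ℕ → ℕ) where
  term : ℕ → ℕ → ℕ
  term i j = 2 * (i + j ∸ (k + 1)) * s (i ∸ 1) * s (2 * k ∸ j)

  formula : ℕ
  formula = sumFromTo 2 k (λ i → sumFromTo (k + 2 ∸ i) k (λ j → term i j))

  formula≡reindexedSum : formula ≡ reindexedSum k s (λ d → 2 * d)
  formula≡reindexedSum = trans (sumFromTo≡Σ 2 k (λ i → sumFromTo (k + 2 ∸ i) k (λ j → term i j))) (Σ-cong (k ∸ 1) inner)
    where
    re : ∀ a b c → a * b * c ≡ b * c * a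
    re = solve-∀
    inner : ∀ t → t < k ∸ 1 → sumFromTo (k + 2 ∸ (2 + t)) k (λ j → term (2 + t) j) ≡ Σ (suc t) (λ t' → s (suc t) * s (k + (t ∸ t')) * (2 * suc t'))
    inner t lt = begin
      sumFromTo (k + 2 ∸ (2 + t)) k (λ j → term (2 + t) j)
        ≡⟨ sumFromTo≡Σ (k + 2 ∸ (2 + t)) k (λ j → term (2 + t) j) ⟩
      Σ (suc k ∸ (k + 2 ∸ (2 + t))) (λ t' → term (2 + t) ((k + 2 ∸ (2 + t)) + t'))
        ≡⟨ cong (λ K → Σ (suc k ∸ K) (λ t' → term (2 + t) (K + t'))) (even-lower k t) ⟩
      Σ (suc k ∸ (k ∸ t)) (λ t' → term (2 + t) ((k ∸ t) + t'))
        ≡⟨ cong (λ m → Σ m (λ t' → term (2 + t) ((k ∸ t) + t'))) (suc[m]∸[m∸n]≡suc[n] k t tk) ⟩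
      Σ (suc t) (λ t' → term (2 + t) ((k ∸ t) + t'))
        ≡⟨ Σ-cong (suc t) (λ t' lt' → trans (cong₂ (λ x y → 2 * x * s (suc t) * s y) (even-weight k t t' tk) (even-partner k t t' (≤-pred lt') tk))
                                             (re (2 * suc t') (s (suc t)) (s (k + (t ∸ t'))))) ⟩
      Σ (suc t) (λ t' → s (suc t) * s (k + (t ∸ t')) * (2 * suc t')) ∎
      where
      open ≡-Reasoning
      tk : t ≤ k
      tk = ≤-trans (<⇒≤ lt) (m∸n≤m k 1)

module OddFormula (k : ℕ) (s : ℕ → ℕ) where
  term : ℕ → ℕ → ℕ
  term i j = (2 * (i + j ∸ k) ∸ 1) * s (i ∸ 1) * s (2 * k ∸ 1 ∸ j)

  formula : ℕ
  formula = sumFromTo 2 k (λ i → sumFromTo (k + 1 ∸ i) (k ∸ 1) (λ j → term i j))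

  formula≡reindexedSum : formula ≡ reindexedSum k s (λ d → 2 * d ∸ 1)
  formula≡reindexedSum = trans (sumFromTo≡Σ 2 k (λ i → sumFromTo (k + 1 ∸ i) (k ∸ 1) (λ j → term i j))) (Σ-cong (k ∸ 1) inner)
    where
    re : ∀ a b c → a * b * c ≡ b * c * a
    re = solve-∀
    inner : ∀ t → t < k ∸ 1 → sumFromTo (k + 1 ∸ (2 + t)) (k ∸ 1) (λ j → term (2 + t) j) ≡ Σ (suc t) (λ t' → s (suc t) * s (k + (t ∸ t')) * (2 * suc t' ∸ 1))
    inner t lt = begin
      sumFromTo (k + 1 ∸ (2 + t)) (k ∸ 1) (λ j → term (2 + t) j)
        ≡⟨ sumFromTo≡Σ (k + 1 ∸ (2 + t)) (k ∸ 1) (λ j → term (2 + t) j) ⟩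
      Σ (suc (k ∸ 1) ∸ (k + 1 ∸ (2 + t))) (λ t' → term (2 + t) ((k + 1 ∸ (2 + t)) + t'))
        ≡⟨ cong (λ K → Σ (suc (k ∸ 1) ∸ K) (λ t' → term (2 + t) (K + t'))) (odd-lower k t) ⟩
      Σ (suc (k ∸ 1) ∸ (k ∸ suc t)) (λ t' → term (2 + t) ((k ∸ suc t) + t'))
        ≡⟨ cong (λ m → Σ m (λ t' → term (2 + t) ((k ∸ suc t) + t'))) (odd-count k t tk) ⟩
      Σ (suc t) (λ t' → term (2 + t) ((k ∸ suc t) + t'))
        ≡⟨ Σ-cong (suc t) (λ t' lt' → trans (cong₂ (λ x y → (2 * x ∸ 1) * s (suc t) * s y) (odd-weight k t t' tk) (odd-partner k t t' (≤-pred lt') tk))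
                                             (re (2 * suc t' ∸ 1) (s (suc t)) (s (k + (t ∸ t'))))) ⟩
      Σ (suc t) (λ t' → s (suc t) * s (k + (t ∸ t')) * (2 * suc t' ∸ 1)) ∎
      where
      open ≡-Reasoning
      tk : suc t ≤ k
      tk = ≤-trans lt (m∸n≤m k 1)

≡ᵇ-refl : ∀ a → (a ≡ᵇ a) ≡ true
≡ᵇ-refl zero = refl
≡ᵇ-refl (suc a) = ≡ᵇ-refl a

≡ᵇ-true⇒≡ : ∀ a b → (a ≡ᵇ b) ≡ true → a ≡ b
≡ᵇ-true⇒≡ zero zero _ = refl
≡ᵇ-true⇒≡ (suc a) (suc b) e = cong suc (≡ᵇ-true⇒≡ a b e)

≢⇒≡ᵇ-false : ∀ a b → ¬ a ≡ b → (a ≡ᵇ b) ≡ false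
≢⇒≡ᵇ-false a b ne = ¬true⇒false (a ≡ᵇ b) (λ e → ne (≡ᵇ-true⇒≡ a b e))

Σ-indicator : ∀ m a (F : ℕ → ℕ) → a < m → Σ m (λ p → indicator (a ≡ᵇ p) * F p) ≡ F a
Σ-indicator (suc m) zero F _ = trans (cong₂ _+_ (+-identityʳ (F 0)) (Σ-zero m (λ t _ → refl))) (+-identityʳ (F 0))
Σ-indicator (suc m) (suc a) F (s≤s lt) = Σ-indicator m a (λ p → F (suc p)) lt

<⇒<ᵇ-true : ∀ m n → m < n → (m <ᵇ n) ≡ true
<⇒<ᵇ-true zero (suc n) _ = refl
<⇒<ᵇ-true (suc m) (suc n) (s≤s lt) = <⇒<ᵇ-true m n lt

≥⇒<ᵇ-false : ∀ m n → n ≤ m → (m <ᵇ n) ≡ false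
≥⇒<ᵇ-false m zero _ = refl
≥⇒<ᵇ-false (suc m) (suc n) (s≤s le) = ≥⇒<ᵇ-false m n le

-- The difference of Wiener indices

half-girth-bounds : ∀ L k → 3 ≤ L → L ≤ 2 * k → 2 * k ≤ suc L → 2 ≤ k × k < L
half-girth-bounds L zero L3 L≤ _ = ⊥-elim (<⇒≱ L3 (≤-trans L≤ z≤n))
half-girth-bounds L (suc zero) L3 L≤ _ = ⊥-elim (<⇒≱ L3 L≤)
half-girth-bounds L (suc (suc k)) _ _ le =
  s≤s (s≤s z≤n) , ≤-trans (m≤m+n (3 + k) k) (≤-pred (≤-trans (≤-reflexive (double k)) le))
  where
  double : ∀ k → 4 + (k + k) ≡ 2 * (2 + k)
  double = solve-∀

module WienerDifference {n : ℕ} (G : Graph n) (g : ℕ) (c : Fin (suc g) → Fin n) (isC : IsCycle G c)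
  (uniq : OnlyCycle G c)
  (conn : Connected (adj G)) (k : ℕ)
  (Lk1 : 2 * k ≤ suc (suc g)) (Lk2 : suc g ≤ 2 * k) where
  open CycleDistances G g c isC uniq conn
  k1 : 1 ≤ k
  k1 = ≤-trans (s≤s z≤n) (proj₁ (half-girth-bounds (suc g) k L3 Lk2 Lk1))
  kL : k < suc g
  kL = proj₂ (half-girth-bounds (suc g) k L3 Lk2 Lk1)
  open MinusEdge k k1 kL
  open CycleSetup G g c using (L; A; F; pos)

  excess : ℕ → ℕ → ℕ
  excess p q = pathDist p q ∸ cycleDist p q

  excess-sym : ∀ p q → excess p q ≡ excess q p
  excess-sym p q = cong₂ _∸_ (pathDist-sym p q) (cycleDist-sym p q)

  cycleDist≤pathDist : ∀ p q → p < L → q < L → cycleDist p q ≤ pathDist p q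
  cycleDist≤pathDist p q pL qL = subst (_≤ pathDist p q) (DistG.dist-cyc p q pL qL) (dist-≤ A (pathDist p q) (reach-⊆ T A T⊆A (pathDist p q) (pathDist-walk p q pL qL)))

  distT≡dist+excess : ∀ u v → dist T u v ≡ dist A u v + excess (root u) (root v)
  distT≡dist+excess u v with root v ≟ℕ root u
  ... | yes eq = trans (DistT.dist-same u v eq) (sym (trans (cong₂ _+_ (DistG.dist-same u v eq) (cong (λ z → pathDist (root u) z ∸ cycleDist (root u) z) eq))
                   (trans (cong (dF u v +_) (cong₂ _∸_ (pathDist-refl (root u)) (cycleDist-refl (root u)))) (+-identityʳ _))))
  ... | no ne = trans (DistT.dist-diff u v ne) (trans (cong (λ z → depth u + z + depth v) (sym (m+[n∸m]≡n (cycleDist≤pathDist (root u) (root v) (root< u) (root< v)))))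
                   (trans (re (depth u) (cycleDist (root u) (root v)) (excess (root u) (root v)) (depth v)) (cong (_+ excess (root u) (root v)) (sym (DistG.dist-diff u v ne)))))
    where
    re : ∀ a b c d → a + (b + c) + d ≡ a + b + d + c
    re = solve-∀

  xs = allFinL n

  ite : Bool → ℕ → ℕ
  ite b x = if b then x else 0

  ite-+ : ∀ b x y → ite b (x + y) ≡ ite b x + ite b y
  ite-+ true x y = refl
  ite-+ false x y = refl

  pairExcess : Fin n → Fin n → ℕ
  pairExcess u v = excess (root u) (root v)

  excessSum : ℕ
  excessSum = ΣL xs (λ u → ΣL xs (λ v → ite (toℕ u <ᵇ toℕ v) (pairExcess u v)))

  Wiener-T : Wiener T ≡ Wiener A + excessSum
  Wiener-T = trans (ΣL-cong xs (λ u → trans (ΣL-cong xs (λ v → trans (cong (ite (toℕ u <ᵇ toℕ v)) (distT≡dist+excess u v)) (ite-+ (toℕ u <ᵇ toℕ v) (dist A u v) (pairExcess u v))))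
                                  (ΣL-+ xs (λ v → ite (toℕ u <ᵇ toℕ v) (dist A u v)) (λ v → ite (toℕ u <ᵇ toℕ v) (pairExcess u v)))))
               (ΣL-+ xs (λ u → ΣL xs (λ v → ite (toℕ u <ᵇ toℕ v) (dist A u v))) (λ u → ΣL xs (λ v → ite (toℕ u <ᵇ toℕ v) (pairExcess u v))))

  Δ≡excessSum : Δ G (pos (k ∸ 1)) (pos k) ≡ ℤ.+ excessSum
  Δ≡excessSum = trans (cong (λ z → ℤ.+ z ℤ.- ℤ.+ Wiener A) Wiener-T)
           (trans (m-n≡m⊖n (Wiener A + excessSum) (Wiener A)) (trans (⊖-≥ (m≤m+n (Wiener A) excessSum)) (cong ℤ.+_ (m+n∸m≡n (Wiener A) excessSum))))

  pairExcess-sym : ∀ u v → pairExcess u v ≡ pairExcess v u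
  pairExcess-sym u v = excess-sym (root u) (root v)

  pairExcess-diag : ∀ u → pairExcess u u ≡ 0
  pairExcess-diag u = cong₂ _∸_ (pathDist-refl (root u)) (cycleDist-refl (root u))

  pairExcess-split : ∀ u v → pairExcess u v ≡ ite (toℕ u <ᵇ toℕ v) (pairExcess u v) + ite (toℕ v <ᵇ toℕ u) (pairExcess u v)
  pairExcess-split u v with <-cmp (toℕ u) (toℕ v)
  ... | tri< lt _ _ rewrite <⇒<ᵇ-true _ _ lt | ≥⇒<ᵇ-false (toℕ v) (toℕ u) (<⇒≤ lt) = sym (+-identityʳ _)
  ... | tri> _ _ gt rewrite <⇒<ᵇ-true _ _ gt | ≥⇒<ᵇ-false (toℕ u) (toℕ v) (<⇒≤ gt) = refl
  ... | tri≈ _ eq _ rewrite toℕ-injective {i = u} {j = v} eq | pairExcess-diag v | ≥⇒<ᵇ-false (toℕ v) (toℕ v) ≤-refl = refl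

  excessSum-double : ΣL xs (λ u → ΣL xs (λ v → pairExcess u v)) ≡ 2 * excessSum
  excessSum-double = begin
    ΣL xs (λ u → ΣL xs (λ v → pairExcess u v))
      ≡⟨ ΣL-cong xs (λ u → trans (ΣL-cong xs (λ v → pairExcess-split u v)) (ΣL-+ xs _ _)) ⟩
    ΣL xs (λ u → ΣL xs (λ v → ite (toℕ u <ᵇ toℕ v) (pairExcess u v)) + ΣL xs (λ v → ite (toℕ v <ᵇ toℕ u) (pairExcess u v)))
      ≡⟨ ΣL-+ xs _ _ ⟩
    excessSum + ΣL xs (λ u → ΣL xs (λ v → ite (toℕ v <ᵇ toℕ u) (pairExcess u v)))
      ≡⟨ cong (excessSum +_) (trans (ΣL-swap xs xs (λ u v → ite (toℕ v <ᵇ toℕ u) (pairExcess u v)))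
                            (ΣL-cong xs (λ v → ΣL-cong xs (λ u → cong (ite (toℕ v <ᵇ toℕ u)) (pairExcess-sym u v))))) ⟩
    excessSum + excessSum
      ≡⟨ sym (2*m≡m+m excessSum) ⟩
    2 * excessSum ∎
    where
    open ≡-Reasoning

  s : ℕ → ℕ
  s p = treeSize G c (pos p)

  reach-root≡ : ∀ p v → p < L → reachWithin F n (pos p) v ≡ (root v ≡ᵇ p)
  reach-root≡ p v pL with root v ≟ℕ p
  ... | yes e rewrite e = trans (subst (λ z → reachWithin F n (pos z) v ≡ true) e (root-reaches v)) (sym (≡ᵇ-refl p))
  ... | no ne = trans (¬true⇒false _ (λ q → ne (root-unique p n v pL q))) (sym (≢⇒≡ᵇ-false (root v) p ne))

  sum-by-root : ∀ (Fn : ℕ → ℕ) → ΣL xs (λ v → Fn (root v)) ≡ Σ L (λ p → s p * Fn p)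
  sum-by-root Fn = begin
    ΣL xs (λ v → Fn (root v))
      ≡⟨ ΣL-cong xs (λ v → sym (Σ-indicator L (root v) Fn (root< v))) ⟩
    ΣL xs (λ v → Σ L (λ p → indicator (root v ≡ᵇ p) * Fn p))
      ≡⟨ ΣL-Σ xs L (λ v p → indicator (root v ≡ᵇ p) * Fn p) ⟩
    Σ L (λ p → ΣL xs (λ v → indicator (root v ≡ᵇ p) * Fn p))
      ≡⟨ Σ-cong L (λ p pL → trans (ΣL-cong xs (λ v → *-comm (indicator (root v ≡ᵇ p)) (Fn p)))
                          (trans (ΣL-* xs (Fn p) (λ v → indicator (root v ≡ᵇ p)))
                          (trans (*-comm (Fn p) _) (cong (_* Fn p) (sym (ΣL-cong xs (λ v → cong indicator (reach-root≡ p v pL)))))))) ⟩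
    Σ L (λ p → s p * Fn p) ∎
    where open ≡-Reasoning

  excessSum-by-roots : ΣL xs (λ u → ΣL xs (λ v → pairExcess u v)) ≡ Σ L (λ q → s q * Σ L (λ p → s p * excess p q))
  excessSum-by-roots = begin
    ΣL xs (λ u → ΣL xs (λ v → excess (root u) (root v)))
      ≡⟨ ΣL-cong xs (λ u → sum-by-root (excess (root u))) ⟩
    ΣL xs (λ u → Σ L (λ q → s q * excess (root u) q))
      ≡⟨ ΣL-Σ xs L (λ u q → s q * excess (root u) q) ⟩
    Σ L (λ q → ΣL xs (λ u → s q * excess (root u) q))
      ≡⟨ Σ-cong L (λ q _ → trans (ΣL-* xs (s q) (λ u → excess (root u) q)) (cong (s q *_) (sum-by-root (λ p → excess p q)))) ⟩
    Σ L (λ q → s q * Σ L (λ p → s p * excess p q)) ∎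
    where open ≡-Reasoning

  m∸[n⊓m]≡m∸n : ∀ x y → x ∸ (y ⊓ x) ≡ x ∸ y
  m∸[n⊓m]≡m∸n x y with ⊓-sel y x
  ... | inj₁ e rewrite e = refl
  ... | inj₂ e rewrite e = trans (n∸n≡0 x) (sym (m≤n⇒m∸n≡0 (subst (_≤ y) e (m⊓n≤m y x))))

  excess-zero : ∀ p q → pathDist p q ≡ ∣ p - q ∣ → ∣ p - q ∣ + ∣ p - q ∣ ≤ L → excess p q ≡ 0
  excess-zero p q e le = trans (cong₂ _∸_ e (m≤n⇒m⊓n≡m (m+n≤o⇒m≤o∸n ∣ p - q ∣ le))) (n∸n≡0 ∣ p - q ∣)

  ∣m-n∣<o : ∀ p q m → p < m → q < m → ∣ p - q ∣ < m
  ∣m-n∣<o zero q m _ qm = qm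
  ∣m-n∣<o (suc p) zero m pm _ = pm
  ∣m-n∣<o (suc p) (suc q) (suc m) (s≤s pm) (s≤s qm) = ≤-trans (∣m-n∣<o p q m pm qm) (n≤1+n m)

  excess-lo : ∀ p q → p < k → q < k → excess p q ≡ 0
  excess-lo p q pk qk = excess-zero p q (pathDist-lo p q pk qk) le
    where
    x = ∣ p - q ∣
    xk : suc x ≤ k
    xk = ∣m-n∣<o p q k pk qk
    le : x + x ≤ L
    le = ≤-trans (n≤1+n (x + x)) (≤-pred (subst (_≤ suc L) (cong suc (+-suc x x)) (≤-trans (+-mono-≤ xk xk) (≤-trans (≤-reflexive (sym (2*m≡m+m k))) Lk1))))

  excess-hi : ∀ p q → k ≤ p → k ≤ q → p < L → q < L → excess p q ≡ 0
  excess-hi p q kp kq pL qL = excess-zero p q (pathDist-hi p q kp kq) le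
    where
    x = ∣ p - q ∣
    xL : suc x ≤ L ∸ k
    xL = subst (_< L ∸ k) (∣m∸o-n∸o∣≡∣m-n∣ k p q kp kq) (∣m-n∣<o (p ∸ k) (q ∸ k) (L ∸ k) (∸-monoˡ-< pL kp) (∸-monoˡ-< qL kq))
    Lk : L ∸ k ≤ k
    Lk = ≤-trans (∸-monoˡ-≤ k Lk2) (≤-reflexive (trans (cong (_∸ k) (2*m≡m+m k)) (m+n∸m≡n k k)))
    le : x + x ≤ L
    le = ≤-trans (+-mono-≤ (≤-trans (n≤1+n x) xL) (≤-trans (n≤1+n x) (≤-trans xL Lk))) (≤-reflexive (m∸n+n≡m (<⇒≤ kL)))

  excess-across : ∀ p q → p < k → k ≤ q → q < L → excess p q ≡ (L ∸ q + p) ∸ (q ∸ p)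
  excess-across p q pk kq qL = trans (cong₂ _∸_ (pathDist-across p q pk kq qL) dce) (m∸[n⊓m]≡m∸n (L ∸ q + p) (q ∸ p))
    where
    pq : p ≤ q
    pq = ≤-trans (<⇒≤ pk) kq
    dce : cycleDist p q ≡ (q ∸ p) ⊓ (L ∸ q + p)
    dce = trans (cong (λ w → w ⊓ (L ∸ w)) (m≤n⇒∣m-n∣≡n∸m pq)) (cong ((q ∸ p) ⊓_) (L∸[q∸p]≡L∸q+p p q pq (<⇒≤ qL)))

  module Pairs = PairSums L k s excess (<⇒≤ kL) excess-sym excess-lo excess-hi

  excessSum≡X : excessSum ≡ Pairs.X
  excessSum≡X = *-cancelˡ-≡ excessSum Pairs.X 2 (trans (sym excessSum-double) (trans excessSum-by-roots Pairs.symmetric-sum≡2X))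

  Δ≡reindexedSum : (C : ℕ → ℕ) → C 0 ≡ 0 → k ∸ 1 ≤ L ∸ k →
    (∀ a b → a < k → b < L ∸ k → excess a (k + b) ≡ C (a ∸ b)) →
    Δ G (pos (k ∸ 1)) (pos k) ≡ ℤ.+ reindexedSum k s C
  Δ≡reindexedSum C C0 kL' cross = begin
    Δ G (pos (k ∸ 1)) (pos k)  ≡⟨ Δ≡excessSum ⟩
    ℤ.+ excessSum              ≡⟨ cong ℤ.+_ excessSum≡X ⟩
    ℤ.+ Pairs.X                ≡⟨ cong ℤ.+_ (Pairs.CrossSum.X≡Y C C0 k1 kL' cross) ⟩
    ℤ.+ reindexedSum k s C     ∎
    where open ≡-Reasoning

  Δ-even-girth : L ≡ 2 * k → Δ G (pos (k ∸ 1)) (pos k) ≡ ℤ.+ EvenFormula.formula k s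
  Δ-even-girth e = trans (Δ≡reindexedSum (2 *_) refl (subst (k ∸ 1 ≤_) (sym L∸k≡k) (m∸n≤m k 1)) cross)
                         (cong ℤ.+_ (sym (EvenFormula.formula≡reindexedSum k s)))
    where
    L∸k≡k : L ∸ k ≡ k
    L∸k≡k = trans (cong (_∸ k) (trans e (2*m≡m+m k))) (m+n∸m≡n k k)
    cross : ∀ a b → a < k → b < L ∸ k → excess a (k + b) ≡ 2 * (a ∸ b)
    cross a b ak bL = trans (excess-across a (k + b) ak (m≤m+n k b) (Pairs.k+b<L b bL))
      (trans (cong (λ z → (z ∸ (k + b) + a) ∸ (k + b ∸ a)) e) (excess-even k a b ak (subst (b <_) L∸k≡k bL)))

  Δ-odd-girth : L ≡ 2 * k ∸ 1 → Δ G (pos (k ∸ 1)) (pos k) ≡ ℤ.+ OddFormula.formula k s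
  Δ-odd-girth e = trans (Δ≡reindexedSum (λ d → 2 * d ∸ 1) refl (≤-reflexive (sym L∸k≡k∸1)) cross)
                        (cong ℤ.+_ (sym (OddFormula.formula≡reindexedSum k s)))
    where
    L∸k≡k∸1 : L ∸ k ≡ k ∸ 1
    L∸k≡k∸1 = trans (cong (_∸ k) e) (trans (∸-+-assoc (2 * k) 1 k) (trans (cong (2 * k ∸_) (+-comm 1 k)) (2k∸[k+b]≡k∸b k 1)))
    cross : ∀ a b → a < k → b < L ∸ k → excess a (k + b) ≡ 2 * (a ∸ b) ∸ 1
    cross a b ak bL = trans (excess-across a (k + b) ak (m≤m+n k b) (Pairs.k+b<L b bL))
      (trans (cong (λ z → (z ∸ (k + b) + a) ∸ (k + b ∸ a)) e)
        (excess-odd k a b ak (≤-trans (s≤s (subst (b <_) L∸k≡k∸1 bL)) (≤-reflexive (m+[n∸m]≡n k1)))))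

2k∸k≡k : ∀ k → 2 * k ∸ k ≡ k
2k∸k≡k k = trans (cong (_∸ k) (2*m≡m+m k)) (m+n∸m≡n k k)

2k∸1∸[k∸1]≡k : ∀ k → 1 ≤ k → 2 * k ∸ 1 ∸ (k ∸ 1) ≡ k
2k∸1∸[k∸1]≡k (suc k) _ = trans (m+n∸m≡n k (suc (k + 0))) (cong suc (+-identityʳ k))

module _ {n : ℕ} (G : Graph n) (g : ℕ) (c : Fin (suc g) → Fin n) (isC : IsCycle G c)
  (uniq : OnlyCycle G c)
  (conn : Connected (adj G)) (k : ℕ) where

  Δ-even : suc g ≡ 2 * k → Δ G (uV c k) (wEven k c k) ≡ ℤ.+ EvenFormula.formula k (treeSize G c ∘ at c)
  Δ-even e = subst (λ z → Δ G (uV c k) (at c z) ≡ ℤ.+ EvenFormula.formula k (treeSize G c ∘ at c)) (sym (2k∸k≡k k))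
    (WienerDifference.Δ-even-girth G g c isC uniq conn k (≤-trans (≤-reflexive (sym e)) (n≤1+n _)) (≤-reflexive e) e)

  Δ-odd : suc g ≡ 2 * k ∸ 1 → Δ G (uV c k) (wOdd k c (k ∸ 1)) ≡ ℤ.+ OddFormula.formula k (treeSize G c ∘ at c)
  Δ-odd e = subst (λ z → Δ G (uV c k) (at c z) ≡ ℤ.+ OddFormula.formula k (treeSize G c ∘ at c)) (sym (2k∸1∸[k∸1]≡k k F.k1)) (F.Δ-odd-girth e)
    where
    module F = WienerDifference G g c isC uniq conn k (≤-trans (m≤n+m∸n (2 * k) 1) (≤-reflexive (sym (cong suc e)))) (≤-trans (≤-reflexive e) (m∸n≤m (2 * k) 1))

-- Imported only here: an unqualified +_ makes sections such as (lo +_) ambiguous.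
open import Data.Integer using (+_)

mainTheorem9 : ∀ {n} (G : Graph n) → Unicyclic G →
    ∀ (k g : ℕ) (c : Fin (suc g) → Fin n) → IsCycle G c →
    (suc g ≡ 2 * k →
      Δ G (uV c k) (wEven k c k) ≡
        + sumFromTo 2 k (λ i → sumFromTo (k + 2 ∸ i) k (λ j →
            2 * (i + j ∸ (k + 1)) * treeSize G c (uV c i) * treeSize G c (wEven k c j))))
    ×
    (suc g ≡ 2 * k ∸ 1 →
      Δ G (uV c k) (wOdd k c (k ∸ 1)) ≡
        + sumFromTo 2 k (λ i → sumFromTo (k + 1 ∸ i) (k ∸ 1) (λ j →
            (2 * (i + j ∸ k) ∸ 1) * treeSize G c (uV c i) * treeSize G c (wOdd k c j))))
mainTheorem9 G (connected , _ , _ , _ , unique₀) k g c cycle =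
  Δ-even G g c cycle unique connected k , Δ-odd G g c cycle unique connected k
  where
  unique : OnlyCycle G c
  unique m c′ cycle′ a b = trans (unique₀ m c′ cycle′ a b) (sym (unique₀ g c cycle a b))
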